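{- Let $G$ be a cyclically $4$-edge-connected cubic graph and let $e$ and $f$ be edges of $G$. Then $G$ has no perfect matching that avoids $e$ and contains $f$ if and only if the graph obtained from $G$ by deleting the edges $e$ and $f$ is bipartite, with both end-vertices of $e$ in one color class and both end-vertices of $f$ in the other color class.
   Context: Graphs may have parallel edges. An edge-cut $E(A,B)$ (edges between a partition $\{A,B\}$ of the vertex set) is cyclic if both induced subgraphs on $A$ and $B$ contain a cycle; a graph is cyclically $4$-edge-connected if it has no cyclic edge-cut with fewer than $4$ edges. -}

module Defs where

open import Data.Nat using (ℕ; zero; suc; _≤_; _%_)
open import Data.Fin using (Fin; toℕ)
open import Data.Fin.Properties using (_≟_)
open import Data.Bool using (Bool; true; false; not; _∨_; _∧_; _xor_)
open import Data.List using (List; length; filterᵇ; allFin)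
open import Data.Product using (_×_; _,_; proj₁; proj₂; Σ; ∃)
open import Data.Sum using (_⊎_)
open import Function using (_∘_)
open import Function.Definitions using (Injective)
open import Relation.Nullary using (¬_)
open import Relation.Nullary.Decidable using (⌊_⌋)
open import Relation.Binary.PropositionalEquality using (_≡_; _≢_)

-- A finite multigraph (parallel edges allowed, no loops):
-- vertices Fin n, edges Fin m, each edge has an (ordered) pair of distinct ends.
record Multigraph : Set where
  field
    n : ℕ
    m : ℕ
    ends : Fin m → Fin n × Fin n
    loopless : ∀ e → proj₁ (ends e) ≢ proj₂ (ends e)

module _ (G : Multigraph) where
  open Multigraph G

  end₁ end₂ : Fin m → Fin n
  end₁ e = proj₁ (ends e)
  end₂ e = proj₂ (ends e)

  incident : Fin m → Fin n → Bool
  incident e v = ⌊ end₁ e ≟ v ⌋ ∨ ⌊ end₂ e ≟ v ⌋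

  -- degree of v (loopless, so each incident edge counts once)
  degree : Fin n → ℕ
  degree v = length (filterᵇ (λ e → incident e v) (allFin m))

  Cubic : Set
  Cubic = ∀ v → degree v ≡ 3

  Joins : Fin m → Fin n → Fin n → Set
  Joins e u v = ends e ≡ (u , v) ⊎ ends e ≡ (v , u)

  -- A cycle of length k = suc (suc j) ≥ 2 all of whose vertices lie in the
  -- vertex subset A (hence a cycle of the induced subgraph G[A]):
  -- distinct vertices vs 0..k-1, distinct edges es 0..k-1, with es i joining
  -- vs i and vs (i+1 mod k).
  record CycleIn (A : Fin n → Bool) : Set where
    field
      j : ℕ
      vs : Fin (suc (suc j)) → Fin n
      es : Fin (suc (suc j)) → Fin m
      vs-inj : Injective _≡_ _≡_ vs
      es-inj : Injective _≡_ _≡_ es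
      inA : ∀ i → A (vs i) ≡ true
      consecutive : ∀ i i′ → toℕ i′ ≡ suc (toℕ i) % suc (suc j) →
                    Joins (es i) (vs i) (vs i′)

  HasCycleIn : (Fin n → Bool) → Set
  HasCycleIn A = CycleIn A

  cutSize : (Fin n → Bool) → ℕ
  cutSize A = length (filterᵇ (λ e → A (end₁ e) xor A (end₂ e)) (allFin m))

  Cyclically4EdgeConnected : Set
  Cyclically4EdgeConnected =
    ∀ (A : Fin n → Bool) → HasCycleIn A → HasCycleIn (not ∘ A) → 4 ≤ cutSize A

  PerfectMatching : (Fin m → Bool) → Set
  PerfectMatching M =
    ∀ v → length (filterᵇ (λ e → M e ∧ incident e v) (allFin m)) ≡ 1

  BipartiteSeparating : Fin m → Fin m → Set
  BipartiteSeparating e f =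
    Σ (Fin n → Bool) λ c → Σ Bool λ b →
      (∀ g → g ≢ e → g ≢ f → c (end₁ g) ≢ c (end₂ g)) ×
      c (end₁ e) ≡ b × c (end₂ e) ≡ b ×
      c (end₁ f) ≡ not b × c (end₂ f) ≡ not b

module Submission where

-- (⇐) ColourCount: counting edge ends at the two colour classes X ∋ ends of e
-- and Y ∋ ends of f, cubicity forces |X| = |Y| while such an M forces
-- |Y| = |X| + 2.
--
-- (⇒) A perfect matching of H = G − e − u − v (u, v the ends of f) lifts to the
-- forbidden M (ForcedEdge), so by Tutte's theorem H has a barrier S.  Parity
-- gives at least |S| + 2 odd classes; cyclic 4-edge-connectivity bounds the cut
-- of each class from below (CyclicCuts), and counting edge ends at S ∪ {u, v}
-- leaves no slack (BarrierAnalysis): S ∪ {u, v} and its complement are the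
-- colour classes.

open import Defs
open import Data.Nat using (ℕ)
open import Data.Fin using (Fin)
open import Data.Bool using (Bool; true; false)
open import Data.Product using (Σ; _×_)
open import Function.Bundles using (_⇔_)
open import Relation.Nullary using (¬_)
open import Relation.Binary.PropositionalEquality using (_≡_; _≢_)

module Booleans where

  open import Data.Fin using (Fin)
  open import Data.Fin.Properties using (_≟_)
  open import Data.Bool using (Bool; true; false; not; _∧_; _∨_)
  open import Data.Sum using (_⊎_; inj₁; inj₂)
  open import Data.Empty using (⊥; ⊥-elim)
  open import Relation.Nullary using (yes; no)
  open import Relation.Nullary.Decidable using (⌊_⌋)
  open import Relation.Binary.PropositionalEquality

  _≡ᵇ_ : ∀ {k} → Fin k → Fin k → Bool
  x ≡ᵇ y = ⌊ x ≟ y ⌋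

  ≡ᵇ-refl : ∀ {k} (x : Fin k) → (x ≡ᵇ x) ≡ true
  ≡ᵇ-refl x with x ≟ x
  ... | yes _ = refl
  ... | no x≢x = ⊥-elim (x≢x refl)

  ≡ᵇ-true : ∀ {k} {x y : Fin k} → (x ≡ᵇ y) ≡ true → x ≡ y
  ≡ᵇ-true {x = x} {y} h with x ≟ y
  ... | yes x≡y = x≡y

  ≡ᵇ-false : ∀ {k} {x y : Fin k} → x ≢ y → (x ≡ᵇ y) ≡ false
  ≡ᵇ-false {x = x} {y} x≢y with x ≟ y
  ... | yes x≡y = ⊥-elim (x≢y x≡y)
  ... | no _ = refl

  ≡ᵇ-false⁻¹ : ∀ {k} {x y : Fin k} → (x ≡ᵇ y) ≡ false → x ≢ y
  ≡ᵇ-false⁻¹ {y = y} h refl with trans (sym h) (≡ᵇ-refl y)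
  ... | ()

  fin-cases : ∀ {k} (x y : Fin k) → x ≡ y ⊎ x ≢ y
  fin-cases x y with x ≟ y
  ... | yes x≡y = inj₁ x≡y
  ... | no x≢y = inj₂ x≢y

  bool-cases : ∀ b → b ≡ true ⊎ b ≡ false
  bool-cases true = inj₁ refl
  bool-cases false = inj₂ refl

  t≢f : ∀ {b} → b ≡ true → b ≡ false → ⊥
  t≢f refl ()

  bool-iff : ∀ {a b} → (a ≡ true → b ≡ true) → (b ≡ true → a ≡ true) → a ≡ b
  bool-iff {true} a⇒b _ = sym (a⇒b refl)
  bool-iff {false} {true} _ b⇒a = b⇒a refl
  bool-iff {false} {false} _ _ = refl

  ∧-true₁ : ∀ {a b} → (a ∧ b) ≡ true → a ≡ true
  ∧-true₁ {true} _ = refl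

  ∧-true₂ : ∀ {a b} → (a ∧ b) ≡ true → b ≡ true
  ∧-true₂ {true} h = h

  ∧-intro : ∀ {a b} → a ≡ true → b ≡ true → (a ∧ b) ≡ true
  ∧-intro refl refl = refl

  ∨-elim : ∀ {a b} → (a ∨ b) ≡ true → a ≡ true ⊎ b ≡ true
  ∨-elim {true} _ = inj₁ refl
  ∨-elim {false} h = inj₂ h

  ∨-introˡ : ∀ {a b} → a ≡ true → (a ∨ b) ≡ true
  ∨-introˡ refl = refl

  ∨-introʳ : ∀ {a b} → b ≡ true → (a ∨ b) ≡ true
  ∨-introʳ {true} _ = refl
  ∨-introʳ {false} h = h

  not-true : ∀ {a} → not a ≡ true → a ≡ false
  not-true {false} _ = refl

  not-false : ∀ {a} → a ≡ false → not a ≡ true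
  not-false refl = refl

module FinSums where

  open import Data.Nat using (ℕ; zero; suc; _+_; _*_; _≤_; _<_; z≤n; s≤s)
  open import Data.Nat.Properties hiding (suc-injective)
  open import Data.Fin using (Fin; zero; suc)
  open import Data.Fin.Properties using (suc-injective)
  open import Data.Bool using (Bool; true; false; not; _∧_; _∨_; _xor_; if_then_else_)
  open import Data.Bool.Properties using (not-involutive; ∧-zeroʳ; ∧-identityʳ; ∧-assoc; ∧-comm)
  open import Data.List using (length; filterᵇ; allFin; tabulate)
  open import Data.Maybe using (Maybe; just; nothing)
  open import Data.Product using (_,_; ∃)
  open import Data.Sum using (inj₁; inj₂)
  open import Data.Empty using (⊥-elim)
  open import Function using (_∘_; id)
  open import Relation.Binary.PropositionalEquality
  open import Algebra.Properties.CommutativeSemigroup +-commutativeSemigroup using (interchange)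
  open Booleans

  ind : Bool → ℕ
  ind true = 1
  ind false = 0

  Σ' : ∀ {k} → (Fin k → ℕ) → ℕ
  Σ' {zero} f = 0
  Σ' {suc k} f = f zero + Σ' (f ∘ suc)

  count : ∀ {k} → (Fin k → Bool) → ℕ
  count P = Σ' (λ i → ind (P i))

  -- Defs counts with list filters; the two counts agree.
  len-filter : ∀ {k} (P : Fin k → Bool) → length (filterᵇ P (allFin k)) ≡ count P
  len-filter P = go P id
    where
    go : ∀ {A : Set} {k} (P : A → Bool) (f : Fin k → A) →
         length (filterᵇ P (tabulate f)) ≡ count (P ∘ f)
    go {k = zero} P f = refl
    go {k = suc k} P f with P (f zero)
    ... | true = cong suc (go P (f ∘ suc))
    ... | false = go P (f ∘ suc)

  Σ'-cong : ∀ {k} {f g : Fin k → ℕ} → (∀ i → f i ≡ g i) → Σ' f ≡ Σ' g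
  Σ'-cong {zero} h = refl
  Σ'-cong {suc k} h = cong₂ _+_ (h zero) (Σ'-cong (h ∘ suc))

  Σ'-mono : ∀ {k} {f g : Fin k → ℕ} → (∀ i → f i ≤ g i) → Σ' f ≤ Σ' g
  Σ'-mono {zero} h = z≤n
  Σ'-mono {suc k} h = +-mono-≤ (h zero) (Σ'-mono (h ∘ suc))

  Σ'-strict : ∀ {k} {f g : Fin k → ℕ} (a : Fin k) → (∀ i → f i ≤ g i) → f a < g a → Σ' f < Σ' g
  Σ'-strict {suc k} zero h lt = +-mono-<-≤ lt (Σ'-mono (h ∘ suc))
  Σ'-strict {suc k} (suc a) h lt = +-mono-≤-< (h zero) (Σ'-strict a (h ∘ suc) lt)

  Σ'-+ : ∀ {k} (f g : Fin k → ℕ) → Σ' (λ i → f i + g i) ≡ Σ' f + Σ' g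
  Σ'-+ {zero} f g = refl
  Σ'-+ {suc k} f g =
    trans (cong (f zero + g zero +_) (Σ'-+ (f ∘ suc) (g ∘ suc)))
          (interchange (f zero) (g zero) (Σ' (f ∘ suc)) (Σ' (g ∘ suc)))

  Σ'-*ʳ : ∀ {k} (f : Fin k → ℕ) c → Σ' (λ i → f i * c) ≡ Σ' f * c
  Σ'-*ʳ {zero} f c = refl
  Σ'-*ʳ {suc k} f c = trans (cong (f zero * c +_) (Σ'-*ʳ (f ∘ suc) c)) (sym (*-distribʳ-+ c (f zero) _))

  Σ'-*ˡ : ∀ {k} c (f : Fin k → ℕ) → Σ' (λ i → c * f i) ≡ c * Σ' f
  Σ'-*ˡ c f = trans (Σ'-cong (λ i → *-comm c (f i))) (trans (Σ'-*ʳ f c) (*-comm (Σ' f) c))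

  Σ'-0 : ∀ {k} {f : Fin k → ℕ} → (∀ i → f i ≡ 0) → Σ' f ≡ 0
  Σ'-0 {zero} h = refl
  Σ'-0 {suc k} h = cong₂ _+_ (h zero) (Σ'-0 (h ∘ suc))

  Σ'-swap : ∀ {k l} (f : Fin k → Fin l → ℕ) →
    Σ' (λ i → Σ' (λ j → f i j)) ≡ Σ' (λ j → Σ' (λ i → f i j))
  Σ'-swap {zero} {l} f = sym (Σ'-0 {l} (λ j → refl))
  Σ'-swap {suc k} {l} f =
    trans (cong (Σ' (f zero) +_) (Σ'-swap (f ∘ suc)))
          (sym (Σ'-+ (f zero) (λ j → Σ' (λ i → f (suc i) j))))

  Σ'-point : ∀ {k} (f : Fin k → ℕ) (a : Fin k) → (∀ i → i ≢ a → f i ≡ 0) → Σ' f ≡ f a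
  Σ'-point {suc k} f zero h =
    trans (cong (f zero +_) (Σ'-0 (λ i → h (suc i) (λ ())))) (+-identityʳ _)
  Σ'-point {suc k} f (suc a) h =
    trans (cong (_+ Σ' (f ∘ suc)) (h zero (λ ())))
          (Σ'-point (f ∘ suc) a (λ i i≢a → h (suc i) (i≢a ∘ suc-injective)))

  Σ'-two : ∀ {k} (f : Fin k → ℕ) (a b : Fin k) → a ≢ b →
    (∀ i → i ≢ a → i ≢ b → f i ≡ 0) → Σ' f ≡ f a + f b
  Σ'-two f a b a≢b h =
    trans (Σ'-cong split)
      (trans (Σ'-+ atA offA) (cong₂ _+_ (trans (Σ'-point atA a atA-0) atA-a) (trans (Σ'-point offA b offA-0) offA-b)))
    where
    atA offA : _ → ℕ
    atA i = if i ≡ᵇ a then f i else 0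
    offA i = if i ≡ᵇ a then 0 else f i
    split : ∀ i → f i ≡ atA i + offA i
    split i with i ≡ᵇ a
    ... | true = sym (+-identityʳ (f i))
    ... | false = refl
    atA-0 : ∀ i → i ≢ a → atA i ≡ 0
    atA-0 i i≢a rewrite ≡ᵇ-false i≢a = refl
    atA-a : atA a ≡ f a
    atA-a rewrite ≡ᵇ-refl a = refl
    offA-0 : ∀ i → i ≢ b → offA i ≡ 0
    offA-0 i i≢b with fin-cases i a
    ... | inj₁ refl rewrite ≡ᵇ-refl i = refl
    ... | inj₂ i≢a rewrite ≡ᵇ-false i≢a = h i i≢a i≢b
    offA-b : offA b ≡ f b
    offA-b rewrite ≡ᵇ-false (λ b≡a → a≢b (sym b≡a)) = refl

  Σ'-indicator : ∀ {k} (a : Fin k) → Σ' (λ i → ind (i ≡ᵇ a)) ≡ 1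
  Σ'-indicator a = trans (Σ'-point _ a (λ i i≢a → cong ind (≡ᵇ-false i≢a))) (cong ind (≡ᵇ-refl a))

  Σ'-pos : ∀ {k} (f : Fin k → ℕ) → 0 < Σ' f → ∃ λ i → 0 < f i
  Σ'-pos {suc k} f p with f zero in eq
  ... | suc x = zero , subst (0 <_) (sym eq) (s≤s z≤n)
  ... | zero with Σ'-pos (f ∘ suc) p
  ... | i , q = suc i , q

  count-cong : ∀ {k} {P Q : Fin k → Bool} → (∀ i → P i ≡ Q i) → count P ≡ count Q
  count-cong h = Σ'-cong (λ i → cong ind (h i))

  ind-mono : ∀ {p q} → (p ≡ true → q ≡ true) → ind p ≤ ind q
  ind-mono {false} _ = z≤n
  ind-mono {true} p⇒q rewrite p⇒q refl = ≤-refl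

  count-mono : ∀ {k} {P Q : Fin k → Bool} → (∀ i → P i ≡ true → Q i ≡ true) → count P ≤ count Q
  count-mono h = Σ'-mono λ i → ind-mono (h i)

  count-strict : ∀ {k} (P Q : Fin k → Bool) (a : Fin k) → (∀ i → P i ≡ true → Q i ≡ true) →
    P a ≡ false → Q a ≡ true → count P < count Q
  count-strict P Q a h pa qa =
    Σ'-strict a (λ i → ind-mono (h i)) (subst₂ (λ p q → ind p < ind q) (sym pa) (sym qa) ≤-refl)

  count-≤ : ∀ {k} (P : Fin k → Bool) → count P ≤ k
  count-≤ {zero} P = z≤n
  count-≤ {suc k} P = +-mono-≤ (ind≤1 (P zero)) (count-≤ (P ∘ suc))
    where ind≤1 : ∀ b → ind b ≤ 1
          ind≤1 true = ≤-refl
          ind≤1 false = z≤n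

  count-true : ∀ {k} → count {k} (λ _ → true) ≡ k
  count-true {zero} = refl
  count-true {suc k} = cong suc (count-true {k})

  count-0 : ∀ {k} {P : Fin k → Bool} → (∀ i → P i ≡ false) → count P ≡ 0
  count-0 h = Σ'-0 (λ i → cong ind (h i))

  count-≥1 : ∀ {k} (P : Fin k → Bool) (a : Fin k) → P a ≡ true → 1 ≤ count P
  count-≥1 {suc k} P zero h rewrite h = s≤s z≤n
  count-≥1 {suc k} P (suc a) h = ≤-trans (count-≥1 (P ∘ suc) a h) (m≤n+m _ (ind (P zero)))

  count-0-inv : ∀ {k} (P : Fin k → Bool) → count P ≡ 0 → ∀ i → P i ≡ false
  count-0-inv P h i with bool-cases (P i)
  ... | inj₂ x = x
  ... | inj₁ x = ⊥-elim (<-irrefl (sym h) (count-≥1 P i x))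

  count-pos : ∀ {k} (P : Fin k → Bool) → 0 < count P → ∃ λ i → P i ≡ true
  count-pos P p with Σ'-pos _ p
  ... | i , q = i , ind-pos q
    where ind-pos : ∀ {b} → 0 < ind b → b ≡ true
          ind-pos {true} _ = refl

  count-change : ∀ {k} (P Q : Fin k → Bool) (a : Fin k) → P a ≡ true → Q a ≡ false →
    (∀ z → z ≢ a → P z ≡ Q z) → suc (count Q) ≡ count P
  count-change {suc k} P Q zero pa qa h rewrite pa | qa =
    cong suc (count-cong (λ i → sym (h (suc i) (λ ()))))
  count-change {suc k} P Q (suc a) pa qa h rewrite h zero (λ ()) =
    trans (sym (+-suc (ind (Q zero)) _))
      (cong (ind (Q zero) +_) (count-change (P ∘ suc) (Q ∘ suc) a pa qa
        (λ z z≢a → h (suc z) (z≢a ∘ suc-injective))))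

  count-unique : ∀ {k} (P : Fin k → Bool) (a : Fin k) → P a ≡ true → (∀ z → P z ≡ true → z ≡ a) → count P ≡ 1
  count-unique {k} P a pa h =
    trans (sym (count-change P (λ _ → false) a pa refl off-a)) (cong suc (count-0 {k} (λ _ → refl)))
    where off-a : ∀ z → z ≢ a → P z ≡ false
          off-a z z≢a with bool-cases (P z)
          ... | inj₁ x = ⊥-elim (z≢a (h z x))
          ... | inj₂ x = x

  count-not : ∀ {k} (K : Fin k → Bool) → count K + count (not ∘ K) ≡ k
  count-not {k} K = trans (sym (Σ'-+ (λ i → ind (K i)) (λ i → ind (not (K i)))))
                     (trans (Σ'-cong (λ i → split (K i))) (count-true {k}))
    where split : ∀ b → ind b + ind (not b) ≡ ind true
          split true = refl
          split false = refl

  anyF : ∀ {k} → (Fin k → Bool) → Bool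
  anyF {zero} P = false
  anyF {suc k} P = P zero ∨ anyF (P ∘ suc)

  anyF-elim : ∀ {k} (P : Fin k → Bool) → anyF P ≡ true → ∃ λ i → P i ≡ true
  anyF-elim {suc k} P h with bool-cases (P zero)
  ... | inj₁ x = zero , x
  ... | inj₂ x rewrite x with anyF-elim (P ∘ suc) h
  ... | i , pi = suc i , pi

  anyF-false : ∀ {k} (P : Fin k → Bool) → anyF P ≡ false → ∀ i → P i ≡ false
  anyF-false {suc k} P h zero with P zero
  ... | false = refl
  anyF-false {suc k} P h (suc i) with P zero
  ... | false = anyF-false (P ∘ suc) h i

  anyF-intro : ∀ {k} (P : Fin k → Bool) i → P i ≡ true → anyF P ≡ true
  anyF-intro {suc k} P zero h rewrite h = refl
  anyF-intro {suc k} P (suc i) h with P zero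
  ... | true = refl
  ... | false = anyF-intro (P ∘ suc) i h

  anyF-cong : ∀ {k} {P Q : Fin k → Bool} → (∀ i → P i ≡ Q i) → anyF P ≡ anyF Q
  anyF-cong {zero} h = refl
  anyF-cong {suc k} h = cong₂ _∨_ (h zero) (anyF-cong (h ∘ suc))

  allF : ∀ {k} → (Fin k → Bool) → Bool
  allF {zero} P = true
  allF {suc k} P = P zero ∧ allF (P ∘ suc)

  allF-elim : ∀ {k} (P : Fin k → Bool) → allF P ≡ true → ∀ i → P i ≡ true
  allF-elim {suc k} P h zero with P zero
  ... | true = refl
  allF-elim {suc k} P h (suc i) with P zero
  ... | true = allF-elim (P ∘ suc) h i

  allF-false : ∀ {k} (P : Fin k → Bool) → allF P ≡ false → ∃ λ i → P i ≡ false
  allF-false {suc k} P h with bool-cases (P zero)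
  ... | inj₂ x = zero , x
  ... | inj₁ x rewrite x with allF-false (P ∘ suc) h
  ... | i , pi = suc i , pi

  -- the first i : Fin k satisfying P; choosing it makes choices canonical
  firstM : ∀ {k} → (Fin k → Bool) → Maybe (Fin k)
  firstM {zero} P = nothing
  firstM {suc k} P = pick (P zero) (firstM (P ∘ suc))
    where pick : Bool → Maybe (Fin _) → Maybe (Fin (suc _))
          pick true _ = just zero
          pick false (just i) = just (suc i)
          pick false nothing = nothing

  firstM-cong : ∀ {k} {P Q : Fin k → Bool} → (∀ i → P i ≡ Q i) → firstM P ≡ firstM Q
  firstM-cong {zero} h = refl
  firstM-cong {suc k} {P} {Q} h rewrite h zero | firstM-cong {P = P ∘ suc} {Q ∘ suc} (h ∘ suc) = refl

  firstM-sound : ∀ {k} (P : Fin k → Bool) {z} → firstM P ≡ just z → P z ≡ true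
  firstM-sound {suc k} P {z} h with P zero in e | firstM (P ∘ suc) in e2
  firstM-sound {suc k} P {zero} h | true | _ = e
  firstM-sound {suc k} P {suc z} () | true | _
  firstM-sound {suc k} P {zero} () | false | just i
  firstM-sound {suc k} P {suc z} refl | false | just i = firstM-sound (P ∘ suc) e2
  firstM-sound {suc k} P {z} () | false | nothing

  firstM-some : ∀ {k} (P : Fin k → Bool) z → P z ≡ true → ∃ λ w → firstM P ≡ just w
  firstM-some {suc k} P z h with P zero in e | firstM (P ∘ suc) in e2
  ... | true | _ = zero , refl
  ... | false | just i = suc i , refl
  firstM-some {suc k} P zero h | false | nothing = ⊥-elim (t≢f h e)
  firstM-some {suc k} P (suc z) h | false | nothing with firstM-some (P ∘ suc) z h
  ... | w , e3 with trans (sym e2) e3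
  ... | ()

  fromMaybe : ∀ {A : Set} → A → Maybe A → A
  fromMaybe d nothing = d
  fromMaybe d (just x) = x

  oddB : ℕ → Bool
  oddB zero = false
  oddB (suc k) = not (oddB k)

  oddB-+2 : ∀ k → oddB (suc (suc k)) ≡ oddB k
  oddB-+2 k = not-involutive (oddB k)

  oddB-+ : ∀ a k → oddB (a + k) ≡ (oddB a xor oddB k)
  oddB-+ zero k = refl
  oddB-+ (suc a) k rewrite oddB-+ a k with oddB a
  ... | true = not-involutive (oddB k)
  ... | false = refl

  oddB-ind : ∀ b → oddB (ind b) ≡ b
  oddB-ind true = refl
  oddB-ind false = refl

  oddB-*2 : ∀ k → oddB (k * 2) ≡ false
  oddB-*2 zero = refl
  oddB-*2 (suc k) = trans (oddB-+2 (k * 2)) (oddB-*2 k)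

  oddB-2* : ∀ k → oddB (2 * k) ≡ false
  oddB-2* k = trans (cong oddB (*-comm 2 k)) (oddB-*2 k)

  oddB-*3 : ∀ k → oddB (k * 3) ≡ oddB k
  oddB-*3 zero = refl
  oddB-*3 (suc k) = trans (oddB-+2 (suc (k * 3))) (cong not (oddB-*3 k))

  oddB-Σ' : ∀ {k} (h : Fin k → ℕ) → oddB (Σ' h) ≡ oddB (count (λ i → oddB (h i)))
  oddB-Σ' {zero} h = refl
  oddB-Σ' {suc k} h =
    trans (oddB-+ (h zero) (Σ' (h ∘ suc)))
      (trans (cong (oddB (h zero) xor_) (oddB-Σ' (h ∘ suc)))
        (sym (trans (oddB-+ (ind (oddB (h zero))) _)
                    (cong (_xor oddB (count (λ i → oddB (h (suc i))))) (oddB-ind (oddB (h zero)))))))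

  rm : ∀ {k} → (Fin k → Bool) → Fin k → Fin k → Bool
  rm W x z = W z ∧ not (z ≡ᵇ x)

  rm-x : ∀ {k} (W : Fin k → Bool) x → rm W x x ≡ false
  rm-x W x rewrite ≡ᵇ-refl x = ∧-zeroʳ (W x)

  rm-other : ∀ {k} (W : Fin k → Bool) x z → z ≢ x → rm W x z ≡ W z
  rm-other W x z z≢x rewrite ≡ᵇ-false z≢x = ∧-identityʳ (W z)

  rm-sub : ∀ {k} (W : Fin k → Bool) x z → rm W x z ≡ true → W z ≡ true
  rm-sub W x z h = ∧-true₁ h

  rm-ne : ∀ {k} (W : Fin k → Bool) x z → rm W x z ≡ true → z ≢ x
  rm-ne W x z h refl = t≢f h (rm-x W x)

  rm-keep : ∀ {k} (W : Fin k → Bool) x z → W z ≡ true → z ≢ x → rm W x z ≡ true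
  rm-keep W x z wz z≢x = trans (rm-other W x z z≢x) wz

  rm-count : ∀ {k} (W : Fin k → Bool) x → W x ≡ true → suc (count (rm W x)) ≡ count W
  rm-count W x wx = count-change W (rm W x) x wx (rm-x W x) (λ z z≢x → sym (rm-other W x z z≢x))

  rm-count-∧ : ∀ {k} (W R : Fin k → Bool) x →
    count (λ z → W z ∧ R z) ≡ ind (W x ∧ R x) + count (λ z → rm W x z ∧ R z)
  rm-count-∧ W R x with bool-cases (W x ∧ R x)
  ... | inj₁ h rewrite h = sym (trans (cong suc (count-cong commute)) (rm-count (λ z → W z ∧ R z) x h))
    where commute : ∀ z → (rm W x z ∧ R z) ≡ rm (λ z → W z ∧ R z) x z
          commute z = trans (∧-assoc (W z) _ (R z))
                        (trans (cong (W z ∧_) (∧-comm (not (z ≡ᵇ x)) (R z))) (sym (∧-assoc (W z) (R z) _)))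
  ... | inj₂ h rewrite h = count-cong same
    where same : ∀ z → (W z ∧ R z) ≡ (rm W x z ∧ R z)
          same z with fin-cases z x
          ... | inj₁ refl = trans h (cong (_∧ R z) (sym (rm-x W z)))
          ... | inj₂ z≢x = cong (_∧ R z) (sym (rm-other W x z z≢x))

  count-≥2 : ∀ {k} (P : Fin k → Bool) x y → x ≢ y → P x ≡ true → P y ≡ true → 2 ≤ count P
  count-≥2 P x y x≢y px py =
    subst (2 ≤_) (rm-count P x px) (s≤s (count-≥1 (rm P x) y (rm-keep P x y py (λ y≡x → x≢y (sym y≡x)))))

-- Arithmetic of doubled indices (used to walk along alternating sequences two
-- steps at a time), bounded existential quantification over ℕ as a Boolean,
-- and search for a least witness.
module NatSearch where

  open import Data.Nat using (ℕ; zero; suc; _+_; _≤_; _<_; s≤s)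
  open import Data.Nat.Properties
  open import Data.Bool using (Bool; true; false; _∨_)
  open import Data.Product using (Σ; _×_; _,_; ∃)
  open import Data.Sum using (_⊎_; inj₁; inj₂)
  open import Data.Empty using (⊥-elim)
  open import Relation.Binary.PropositionalEquality
  open import Relation.Binary.Definitions using (tri<; tri≈; tri>)
  open import Algebra.Properties.CommutativeSemigroup +-commutativeSemigroup using (interchange)
  open Booleans

  even-or-odd : ∀ t → ∃ λ s → t ≡ s + s ⊎ t ≡ suc (s + s)
  even-or-odd zero = 0 , inj₁ refl
  even-or-odd (suc t) with even-or-odd t
  ... | s , inj₁ e = s , inj₂ (cong suc e)
  ... | s , inj₂ e = suc s , inj₁ (trans (cong suc e) (cong suc (sym (+-suc s s))))

  dbl-suc : ∀ s → suc s + suc s ≡ suc (suc (s + s))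
  dbl-suc s = cong suc (+-suc s s)

  dbl-< : ∀ {s i} → s < i → s + s < i + i
  dbl-< h = +-mono-< h h

  dbl-<-inv : ∀ {s i} → s + s < i + i → s < i
  dbl-<-inv {s} {i} h with <-cmp s i
  ... | tri< s<i _ _ = s<i
  ... | tri≈ _ refl _ = ⊥-elim (<-irrefl refl h)
  ... | tri> _ _ i<s = ⊥-elim (<-asym h (dbl-< i<s))

  odd-< : ∀ {s i} → s < i → suc (s + s) < i + i
  odd-< {s} {suc i} (s≤s h) = s≤s (subst (λ z → s + s < z) (sym (+-suc i i)) (s≤s (+-mono-≤ h h)))

  odd-<-inv : ∀ {s i} → suc (s + s) < i + i → s < i
  odd-<-inv {s} {i} h = dbl-<-inv (<-trans (n<1+n (s + s)) h)

  exB : ℕ → (ℕ → Bool) → Bool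
  exB zero P = false
  exB (suc K) P = exB K P ∨ P K

  exB-intro : ∀ {K P t} → t < K → P t ≡ true → exB K P ≡ true
  exB-intro {suc K} {P} {t} (s≤s h) pt with m≤n⇒m<n∨m≡n h
  ... | inj₁ lt = ∨-introˡ (exB-intro lt pt)
  ... | inj₂ refl = ∨-introʳ {exB K P} pt

  exB-elim : ∀ {K P} → exB K P ≡ true → ∃ λ t → t < K × P t ≡ true
  exB-elim {suc K} {P} h with ∨-elim {exB K P} h
  ... | inj₂ h' = K , n<1+n K , h'
  ... | inj₁ h' with exB-elim {K} h'
  ... | t , lt , pt = t , m<n⇒m<1+n lt , pt

  search : (P : ℕ → Bool) → ∀ K →
    (Σ ℕ λ k → P k ≡ true × k < K × (∀ j → j < k → P j ≡ false)) ⊎ (∀ j → j < K → P j ≡ false)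
  search P zero = inj₂ (λ j ())
  search P (suc K) with search P K
  ... | inj₁ (k , pk , lt , least) = inj₁ (k , pk , m<n⇒m<1+n lt , least)
  ... | inj₂ none with bool-cases (P K)
  ... | inj₁ pK = inj₁ (K , pK , n<1+n K , none)
  ... | inj₂ pK = inj₂ λ j j<1+K → below-or-at j (m≤n⇒m<n∨m≡n (≤-pred j<1+K))
    where
    below-or-at : ∀ j → j < K ⊎ j ≡ K → P j ≡ false
    below-or-at j (inj₁ lt) = none j lt
    below-or-at j (inj₂ refl) = pK

  minimize : (P : ℕ → Bool) → ∀ K → P K ≡ true →
    Σ ℕ λ k → P k ≡ true × k ≤ K × (∀ j → j < k → P j ≡ false)
  minimize P K pK with search P (suc K)
  ... | inj₁ (k , pk , lt , least) = k , pk , ≤-pred lt , least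
  ... | inj₂ none = ⊥-elim (t≢f pK (none K (n<1+n K)))

  dbl-+ : ∀ a b → (a + b) + (a + b) ≡ (b + b) + (a + a)
  dbl-+ a b = trans (interchange a b a b) (+-comm (a + a) (b + b))

-- Perfect matchings of the graph on a vertex set W ⊆ Fin n whose adjacency is a
-- symmetric Boolean relation, presented as a fixed-point-free involution of W
-- along edges; the operations on them that Tutte's theorem needs.
module Matchings where

  open import Data.Nat using (ℕ; _<_)
  open import Data.Fin using (Fin)
  open import Data.Bool using (Bool; true; false; not; _∧_; _∨_; if_then_else_)
  open import Data.Bool.Properties using (∨-comm; ∧-comm)
  open import Data.Product using (_×_; _,_)
  open import Data.Sum using (_⊎_; inj₁; inj₂)
  open import Data.Empty using (⊥-elim)
  open import Relation.Binary.PropositionalEquality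
  open Booleans
  open FinSums

  module _ {n : ℕ} where

    Sym : (Fin n → Fin n → Bool) → Set
    Sym adj = ∀ x y → adj x y ≡ adj y x

    record PM (W : Fin n → Bool) (adj : Fin n → Fin n → Bool) : Set where
      field
        p : Fin n → Fin n
        pW : ∀ x → W x ≡ true → W (p x) ≡ true
        pp : ∀ x → W x ≡ true → p (p x) ≡ x
        pne : ∀ x → W x ≡ true → p x ≢ x
        padj : ∀ x → W x ≡ true → adj x (p x) ≡ true

    adjPlus : (Fin n → Fin n → Bool) → Fin n → Fin n → Fin n → Fin n → Bool
    adjPlus adj a c x y = adj x y ∨ (((x ≡ᵇ a) ∧ (y ≡ᵇ c)) ∨ ((x ≡ᵇ c) ∧ (y ≡ᵇ a)))

    plus-weak : ∀ {adj a c x y} → adj x y ≡ true → adjPlus adj a c x y ≡ true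
    plus-weak h = ∨-introˡ h

    plus-elim : ∀ {adj a c x y} → adjPlus adj a c x y ≡ true → x ≢ a → x ≢ c → adj x y ≡ true
    plus-elim {adj} {a} {c} {x} {y} h x≢a x≢c with adj x y
    ... | true = refl
    ... | false rewrite ≡ᵇ-false x≢a | ≡ᵇ-false x≢c = h

    plus-sym : ∀ {adj} → Sym adj → ∀ a c → Sym (adjPlus adj a c)
    plus-sym {adj} s a c x y =
      cong₂ _∨_ (s x y)
        (trans (∨-comm ((x ≡ᵇ a) ∧ (y ≡ᵇ c)) _)
               (cong₂ _∨_ (∧-comm (x ≡ᵇ c) (y ≡ᵇ a)) (∧-comm (x ≡ᵇ a) (y ≡ᵇ c))))

    pm-empty : ∀ {W} {adj : Fin n → Fin n → Bool} → (∀ z → W z ≡ false) → PM W adj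
    pm-empty {W} h = record { p = λ z → z ; pW = absurd ; pp = absurd ; pne = absurd ; padj = absurd }
      where absurd : ∀ {A : Fin n → Set} z → W z ≡ true → A z
            absurd z w = ⊥-elim (t≢f w (h z))

    pm-extend : ∀ {W adj} → Sym adj → ∀ x y → W x ≡ true → W y ≡ true → x ≢ y → adj x y ≡ true →
      PM (rm (rm W x) y) adj → PM W adj
    pm-extend {W} {adj} sa x y wx wy x≢y axy pm = record { p = q ; pW = qW ; pp = qq ; pne = qne ; padj = qadj }
      where
      open PM pm
      W'' = rm (rm W x) y
      q : Fin n → Fin n
      q z = if z ≡ᵇ x then y else (if z ≡ᵇ y then x else p z)
      qx : q x ≡ y
      qx rewrite ≡ᵇ-refl x = refl
      qy : q y ≡ x
      qy rewrite ≡ᵇ-false (λ y≡x → x≢y (sym y≡x)) | ≡ᵇ-refl y = refl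
      qo : ∀ z → z ≢ x → z ≢ y → q z ≡ p z
      qo z z≢x z≢y rewrite ≡ᵇ-false z≢x | ≡ᵇ-false z≢y = refl
      classify : ∀ z → W z ≡ true → z ≡ x ⊎ (z ≡ y ⊎ W'' z ≡ true)
      classify z wz with fin-cases z x | fin-cases z y
      ... | inj₁ e | _ = inj₁ e
      ... | inj₂ _ | inj₁ e = inj₂ (inj₁ e)
      ... | inj₂ z≢x | inj₂ z≢y = inj₂ (inj₂ (rm-keep (rm W x) y z (rm-keep W x z wz z≢x) z≢y))
      rest : ∀ z → W'' z ≡ true → q z ≡ p z
      rest z h = qo z (rm-ne W x z (rm-sub (rm W x) y z h)) (rm-ne (rm W x) y z h)
      qW : ∀ z → W z ≡ true → W (q z) ≡ true
      qW z wz with classify z wz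
      ... | inj₁ refl rewrite qx = wy
      ... | inj₂ (inj₁ refl) rewrite qy = wx
      ... | inj₂ (inj₂ h) rewrite rest z h = rm-sub W x _ (rm-sub (rm W x) y _ (pW z h))
      qq : ∀ z → W z ≡ true → q (q z) ≡ z
      qq z wz with classify z wz
      ... | inj₁ refl rewrite qx = qy
      ... | inj₂ (inj₁ refl) rewrite qy = qx
      ... | inj₂ (inj₂ h) rewrite rest z h | rest (p z) (pW z h) = pp z h
      qne : ∀ z → W z ≡ true → q z ≢ z
      qne z wz with classify z wz
      ... | inj₁ refl rewrite qx = λ y≡x → x≢y (sym y≡x)
      ... | inj₂ (inj₁ refl) rewrite qy = x≢y
      ... | inj₂ (inj₂ h) rewrite rest z h = pne z h
      qadj : ∀ z → W z ≡ true → adj z (q z) ≡ true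
      qadj z wz with classify z wz
      ... | inj₁ refl rewrite qx = axy
      ... | inj₂ (inj₁ refl) rewrite qy = trans (sa y x) axy
      ... | inj₂ (inj₂ h) rewrite rest z h = padj z h

    pm-demote : ∀ {W} {adj : Fin n → Fin n → Bool} {a c} (pm : PM W (adjPlus adj a c)) →
      W c ≡ true → PM.p pm a ≢ c → PM W adj
    pm-demote {W} {adj} {a} {c} pm wc pa≢c = record { p = p ; pW = pW ; pp = pp ; pne = pne ; padj = padj' }
      where
      open PM pm
      pc≢a : W a ≡ true → p c ≢ a
      pc≢a wa pc≡a = pa≢c (trans (cong p (sym pc≡a)) (pp c wc))
      added : ∀ x → adj x (p x) ≡ false → adjPlus adj a c x (p x) ≡ true → x ≡ a × p x ≡ c ⊎ x ≡ c × p x ≡ a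
      added x old h with adj x (p x)
      added x refl h | false with ∨-elim {(x ≡ᵇ a) ∧ (p x ≡ᵇ c)} h
      ... | inj₁ h₁ = inj₁ (≡ᵇ-true (∧-true₁ h₁) , ≡ᵇ-true (∧-true₂ {x ≡ᵇ a} h₁))
      ... | inj₂ h₂ = inj₂ (≡ᵇ-true (∧-true₁ h₂) , ≡ᵇ-true (∧-true₂ {x ≡ᵇ c} h₂))
      padj' : ∀ x → W x ≡ true → adj x (p x) ≡ true
      padj' x wx with bool-cases (adj x (p x))
      ... | inj₁ old = old
      ... | inj₂ new with added x new (padj x wx)
      ... | inj₁ (refl , px≡c) = ⊥-elim (pa≢c px≡c)
      ... | inj₂ (refl , px≡a) = ⊥-elim (pc≢a (subst (λ z → W z ≡ true) px≡a (pW x wx)) px≡a)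

    -- number of ordered non-adjacent pairs in W (the measure of Tutte's induction)
    nonEdges : (W : Fin n → Bool) (adj : Fin n → Fin n → Bool) → ℕ
    nonEdges W adj = Σ' (λ x → count (λ y → W x ∧ (W y ∧ not (adj x y))))

    nonEdges-dec : ∀ W adj a c → W a ≡ true → W c ≡ true → adj a c ≡ false →
      nonEdges W (adjPlus adj a c) < nonEdges W adj
    nonEdges-dec W adj a c wa wc ac =
      Σ'-strict a (λ x → count-mono (λ y → mono x y)) (count-strict _ _ c (λ y → mono a y) newGone wasMissing)
      where
      mono : ∀ x y → (W x ∧ (W y ∧ not (adjPlus adj a c x y))) ≡ true → (W x ∧ (W y ∧ not (adj x y))) ≡ true
      mono x y h with adj x y | W x | W y
      ... | true | _ | _ = h
      ... | false | true | true = refl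
      ... | false | false | _ = h
      ... | false | true | false = h
      added : adjPlus adj a c a c ≡ true
      added = ∨-introʳ {adj a c} (∨-introˡ (∧-intro (≡ᵇ-refl a) (≡ᵇ-refl c)))
      newGone : (W a ∧ (W c ∧ not (adjPlus adj a c a c))) ≡ false
      newGone rewrite added | wa | wc = refl
      wasMissing : (W a ∧ (W c ∧ not (adj a c))) ≡ true
      wasMissing rewrite wa | wc | ac = refl

-- The exchange step of Lovász's proof of Tutte's theorem.  Let ab and bc be
-- edges, d a vertex with b ≢ a, c and d ≢ a, c, M₁ a perfect matching of
-- adj + ac containing ac and M₂ one of adj + bd containing bd.  Walking from d
-- alternately along M₁ and M₂ traces the alternating cycle C of M₁ ∪ M₂ through
-- bd; it returns to d after an even number 2k₀ + 2 of steps, the last edge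
-- being bd.  If C avoids a and c at the ends of its M₁-edges, take M₁ on C and
-- M₂ elsewhere; otherwise cut C at the first such vertex v ∈ {a, c}, take M₁
-- on the part d … v, the edge bv, and M₂ elsewhere.  Either way the result is
-- a perfect matching of adj itself.
module Exchange {n : ℕ} (W : Fin n → Bool) (adj : Fin n → Fin n → Bool) (sym-adj : Matchings.Sym adj)
  (a b c d : Fin n) (Wa : W a ≡ true) (Wb : W b ≡ true) (Wc : W c ≡ true) (Wd : W d ≡ true)
  (ba : adj b a ≡ true) (bc : adj b c ≡ true) (b≢a : b ≢ a) (b≢c : b ≢ c) (d≢a : d ≢ a) (d≢c : d ≢ c)
  (pm1 : Matchings.PM W (Matchings.adjPlus adj a c)) (p1a : Matchings.PM.p pm1 a ≡ c)
  (pm2 : Matchings.PM W (Matchings.adjPlus adj b d)) (p2b : Matchings.PM.p pm2 b ≡ d) where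

  open import Data.Nat using (zero; suc; _+_; _<_; z≤n; s≤s)
  open import Data.Nat.Properties
  open import Data.Fin using (toℕ)
  open import Data.Fin.Properties using (pigeonhole)
  open import Data.Bool using (false; not; _∨_; if_then_else_)
  open import Data.Bool.Properties using (not-involutive)
  open import Data.Product using (_×_; _,_; proj₁; proj₂; ∃)
  open import Data.Sum using (_⊎_; inj₁; inj₂)
  open import Data.Empty using (⊥; ⊥-elim)
  open import Function using (_∘_)
  open import Relation.Binary.PropositionalEquality
  open Booleans
  open Matchings
  open NatSearch

  open PM pm1 renaming (p to p1; pW to p1W; pp to p1p; pne to p1ne; padj to p1adj)
  open PM pm2 renaming (p to p2; pW to p2W; pp to p2p; pne to p2ne; padj to p2adj)

  ev : ℕ → Bool
  ev zero = true
  ev (suc t) = not (ev t)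

  step : ℕ → Fin n → Fin n
  step t y = if ev t then p1 y else p2 y

  walk : ℕ → Fin n
  walk zero = d
  walk (suc t) = step t (walk t)

  stepW : ∀ t {y} → W y ≡ true → W (step t y) ≡ true
  stepW t h with ev t
  ... | true = p1W _ h
  ... | false = p2W _ h

  stepInv : ∀ t {y} → W y ≡ true → step t (step t y) ≡ y
  stepInv t h with ev t
  ... | true = p1p _ h
  ... | false = p2p _ h

  stepNe : ∀ t {y} → W y ≡ true → step t y ≢ y
  stepNe t h with ev t
  ... | true = p1ne _ h
  ... | false = p2ne _ h

  walkW : ∀ t → W (walk t) ≡ true
  walkW zero = Wd
  walkW (suc t) = stepW t (walkW t)

  ev-dbl : ∀ g s → ev (g + g + s) ≡ ev s
  ev-dbl zero s = refl
  ev-dbl (suc g) s = begin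
      ev (suc g + suc g + s)
    ≡⟨ cong (λ z → ev (z + s)) (dbl-suc g) ⟩
      ev (suc (suc (g + g + s)))
    ≡⟨ not-involutive _ ⟩
      ev (g + g + s)
    ≡⟨ ev-dbl g s ⟩ ev s ∎
    where open ≡-Reasoning

  ev-even : ∀ s → ev (s + s) ≡ true
  ev-even s = trans (cong ev (sym (+-identityʳ (s + s)))) (ev-dbl s 0)

  ev-odd : ∀ s → ev (suc (s + s)) ≡ false
  ev-odd s rewrite ev-even s = refl

  w-even : ∀ s → walk (suc (s + s)) ≡ p1 (walk (s + s))
  w-even s with ev (s + s) | ev-even s
  ... | true | _ = refl

  w-odd : ∀ s → walk (suc (suc (s + s))) ≡ p2 (walk (suc (s + s)))
  w-odd s with ev (suc (s + s)) | ev-odd s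
  ... | false | _ = refl

  w-even' : ∀ s → p1 (walk (suc (s + s))) ≡ walk (s + s)
  w-even' s = trans (cong p1 (w-even s)) (p1p _ (walkW (s + s)))

  w-odd' : ∀ s → p2 (walk (suc (suc (s + s)))) ≡ walk (suc (s + s))
  w-odd' s = trans (cong p2 (w-odd s)) (p2p _ (walkW (suc (s + s))))

  -- a vertex never recurs after an odd number of steps: otherwise folding the
  -- walk back on itself would produce a fixed point of one matching
  reflect : ∀ g s → walk s ≡ walk (suc (g + g) + s) → ⊥
  reflect zero s e = stepNe s (walkW s) (sym e)
  reflect (suc g) s e = reflect g (suc s) earlier
    where
    T = suc (g + g) + suc s
    regroup : suc (suc g + suc g) + s ≡ suc T
    regroup = trans (cong (λ z → suc (z + s)) (dbl-suc g)) (cong (suc ∘ suc) (sym (+-suc (g + g) s)))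
    oneStep : walk s ≡ step T (walk T)
    oneStep = trans e (cong walk regroup)
    evT : ev T ≡ ev s
    evT = trans (cong not (ev-dbl g (suc s))) (not-involutive (ev s))
    stepEq : ∀ y → step s y ≡ step T y
    stepEq y rewrite evT = refl
    earlier : walk (suc s) ≡ walk T
    earlier = begin
        step s (walk s)
      ≡⟨ cong (step s) oneStep ⟩
        step s (step T (walk T))
      ≡⟨ stepEq _ ⟩
        step T (step T (walk T))
      ≡⟨ stepInv T (walkW T) ⟩
        walk T ∎
      where open ≡-Reasoning

  down : ∀ i g → walk i ≡ walk (g + g + i) → walk 0 ≡ walk (g + g)
  down zero g e = trans e (cong walk (+-identityʳ (g + g)))
  down (suc i) g e = down i g earlier
    where
    oneStep : step i (walk i) ≡ step (g + g + i) (walk (g + g + i))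
    oneStep = trans e (cong walk (+-suc (g + g) i))
    stepEq : ∀ y → step (g + g + i) y ≡ step i y
    stepEq y rewrite ev-dbl g i = refl
    earlier : walk i ≡ walk (g + g + i)
    earlier = begin
        walk i
      ≡⟨ sym (stepInv i (walkW i)) ⟩
        step i (step i (walk i))
      ≡⟨ cong (step i) oneStep ⟩
        step i (step (g + g + i) (walk (g + g + i)))
      ≡⟨ cong (step i) (stepEq _) ⟩
        step i (step i (walk (g + g + i)))
      ≡⟨ stepInv i (walkW (g + g + i)) ⟩
        walk (g + g + i) ∎
      where open ≡-Reasoning

  periodExists : ∃ λ K → walk (suc (suc (K + K))) ≡ d
  periodExists with pigeonhole (n<1+n n) (λ (j : Fin (suc n)) → walk (toℕ j + toℕ j))
  ... | i , j , i<j , e with m≤n⇒∃[o]m+o≡n i<j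
  ... | g , eg = g , sym (trans (down (toℕ i + toℕ i) (suc g) e')
                         (cong walk (dbl-suc g)))
    where
    regroup : ∀ ti g → (suc ti + g) + (suc ti + g) ≡ suc g + suc g + (ti + ti)
    regroup ti g = trans (cong (λ z → z + z) (sym (+-suc ti g))) (dbl-+ ti (suc g))
    e' : walk (toℕ i + toℕ i) ≡ walk (suc g + suc g + (toℕ i + toℕ i))
    e' = trans e (cong walk (trans (cong (λ z → z + z) (sym eg)) (regroup (toℕ i) g)))


  -- From now on 2k₀ + 2 is the least even return time to d; the step before
  -- the return is the edge db of M₂.  Q j says that the M₁-edge leaving position
  -- 2j starts at a or c, i.e. that C passes through the added edge ac there.
  module Main (k0 : ℕ) (per : walk (suc (suc (k0 + k0))) ≡ d)
    (perMin : ∀ j → j < k0 → walk (suc (suc (j + j))) ≢ d) where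
    p2d : p2 d ≡ b
    p2d = trans (cong p2 (sym p2b)) (p2p b Wb)

    p1c : p1 c ≡ a
    p1c = trans (cong p1 (sym p1a)) (p1p a Wa)

    bpos : walk (suc (k0 + k0)) ≡ b
    bpos = trans (sym (w-odd' k0)) (trans (cong p2 per) p2d)

    p1-AC : ∀ {y} → W y ≡ true → y ≢ a → y ≢ c → p1 y ≢ a × p1 y ≢ c
    p1-AC {y} h ya yc = (λ e → yc (trans (sym (p1p y h)) (trans (cong p1 e) p1a)))
                      , (λ e → ya (trans (sym (p1p y h)) (trans (cong p1 e) p1c)))

    inAC : Fin n → Bool
    inAC y = (y ≡ᵇ a) ∨ (y ≡ᵇ c)

    inAC-false : ∀ {y} → inAC y ≡ false → y ≢ a × y ≢ c
    inAC-false {y} h with y ≡ᵇ a in e1 | y ≡ᵇ c in e2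
    ... | false | false = ≡ᵇ-false⁻¹ e1 , ≡ᵇ-false⁻¹ e2

    inAC-true : ∀ {y} → inAC y ≡ true → y ≡ a ⊎ y ≡ c
    inAC-true {y} h with y ≡ᵇ a in e1 | y ≡ᵇ c in e2
    ... | true | _ = inj₁ (≡ᵇ-true e1)
    ... | false | true = inj₂ (≡ᵇ-true e2)

    Q : ℕ → Bool
    Q j = inAC (walk (j + j))

    -- The set A of positions before 2i, when no earlier even position meets
    -- {a, c}: it is closed under M₁ and avoids a and c.
    module Below (i : ℕ) (noQ : ∀ j → j < i → Q j ≡ false) where
      notAC-walk : ∀ t → t < i + i → walk t ≢ a × walk t ≢ c
      notAC-walk t lt with even-or-odd t
      ... | s , inj₁ refl = inAC-false (noQ s (dbl-<-inv lt))
      ... | s , inj₂ refl = subst (λ z → z ≢ a × z ≢ c) (sym (w-even s))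
            (p1-AC (walkW (s + s)) (proj₁ (inAC-false (noQ s (odd-<-inv lt)))) (proj₂ (inAC-false (noQ s (odd-<-inv lt)))))

      inA : Fin n → Bool
      inA y = exB (i + i) (λ t → walk t ≡ᵇ y)

      inA-intro : ∀ {t} → t < i + i → inA (walk t) ≡ true
      inA-intro {t} lt = exB-intro {P = λ t' → walk t' ≡ᵇ walk t} lt (≡ᵇ-refl (walk t))

      A-p1 : ∀ {y} → inA y ≡ true → inA (p1 y) ≡ true
      A-p1 {y} h with exB-elim {i + i} h
      ... | t , lt , e with ≡ᵇ-true e | even-or-odd t
      ... | refl | s , inj₁ refl = subst (λ z → inA z ≡ true) (w-even s) (inA-intro (odd-< {s} {i} (dbl-<-inv {s} {i} lt)))
      ... | refl | s , inj₂ refl = subst (λ z → inA z ≡ true) (sym (w-even' s)) (inA-intro (<-trans (n<1+n _) lt))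

      A-notAC : ∀ {y} → inA y ≡ true → y ≢ a × y ≢ c
      A-notAC {y} h with exB-elim {i + i} h
      ... | t , lt , e with ≡ᵇ-true e
      ... | refl = notAC-walk t lt

    -- C never uses ac: switch to M₁ on C, keep M₂ elsewhere.
    module CaseA (none : ∀ j → j < suc k0 → Q j ≡ false) where
      open Below (suc k0) none

      L< : ∀ {t} → t < suc (suc (k0 + k0)) → t < suc k0 + suc k0
      L< {t} lt = subst (t <_) (sym (dbl-suc k0)) lt

      b∈A : inA b ≡ true
      b∈A = subst (λ z → inA z ≡ true) bpos (inA-intro (L< (n<1+n _)))

      d∈A : inA d ≡ true
      d∈A = inA-intro {0} (s≤s z≤n)

      A-p2 : ∀ {y} → inA y ≡ true → inA (p2 y) ≡ true
      A-p2 {y} h with exB-elim {suc k0 + suc k0} h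
      ... | t , lt , e with ≡ᵇ-true e | even-or-odd t
      ... | refl | zero , inj₁ refl = subst (λ z → inA z ≡ true) (sym p2d) b∈A
      ... | refl | suc s , inj₁ refl =
          subst (λ z → inA z ≡ true) (trans (sym (w-odd' s)) (cong p2 (cong walk (sym (dbl-suc s)))))
            (inA-intro (<-trans (subst (suc (s + s) <_) (sym (dbl-suc s)) (≤-refl)) lt))
      ... | refl | s , inj₂ refl with m≤n⇒m<n∨m≡n (≤-pred (odd-<-inv {s} {suc k0} lt))
      ... | inj₁ s<k0 = subst (λ z → inA z ≡ true) (trans (cong walk (dbl-suc s)) (w-odd s))
                          (inA-intro (dbl-< {suc s} {suc k0} (s≤s s<k0)))
      ... | inj₂ refl = subst (λ z → inA z ≡ true) (trans (sym per) (w-odd s)) d∈A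

      q : Fin n → Fin n
      q y = if inA y then p1 y else p2 y

      pmA : PM W adj
      pmA = record { p = q ; pW = qW ; pp = qq ; pne = qne ; padj = qadj }
        where
        qW : ∀ y → W y ≡ true → W (q y) ≡ true
        qW y h with inA y
        ... | true = p1W y h
        ... | false = p2W y h
        qq : ∀ y → W y ≡ true → q (q y) ≡ y
        qq y h with inA y in e
        ... | true rewrite A-p1 e = p1p y h
        ... | false with inA (p2 y) in e2
        ... | true = ⊥-elim (t≢f (subst (λ z → inA z ≡ true) (p2p y h) (A-p2 e2)) e)
        ... | false = p2p y h
        qne : ∀ y → W y ≡ true → q y ≢ y
        qne y h with inA y
        ... | true = p1ne y h
        ... | false = p2ne y h
        qadj : ∀ y → W y ≡ true → adj y (q y) ≡ true
        qadj y h with inA y in e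
        ... | true = plus-elim {adj = adj} {a = a} {c = c} (p1adj y h) (proj₁ (A-notAC e)) (proj₂ (A-notAC e))
        ... | false = plus-elim {adj = adj} {a = b} {c = d} (p2adj y h) (λ { refl → t≢f b∈A e }) (λ { refl → t≢f d∈A e })

    -- C first uses ac at position 2i, at v ∈ {a, c}: switch to M₁ on the path
    -- d … walk (2i − 1), match b with v, keep M₂ elsewhere.
    module CaseB (i' : ℕ) (Qi : Q (suc i') ≡ true) (i<k : suc i' < suc k0)
                 (minQ : ∀ j → j < suc i' → Q j ≡ false) where
      i = suc i'
      open Below i minQ

      v : Fin n
      v = walk (i + i)

      vAC : v ≡ a ⊎ v ≡ c
      vAC = inAC-true Qi

      d∈A : inA d ≡ true
      d∈A = inA-intro {0} (s≤s z≤n)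

      v∉A : inA v ≡ true → ⊥
      v∉A h with exB-elim {i + i} h
      ... | t , lt , e with even-or-odd t
      ... | s , inj₁ refl = case vAC
        where
        nac = notAC-walk (s + s) lt
        case : v ≡ a ⊎ v ≡ c → ⊥
        case (inj₁ x) = proj₁ nac (trans (≡ᵇ-true e) x)
        case (inj₂ x) = proj₂ nac (trans (≡ᵇ-true e) x)
      ... | s , inj₂ refl with m≤n⇒∃[o]m+o≡n (odd-<-inv {s} {i} lt)
      ... | g , eg = reflect g (suc (s + s)) (trans (≡ᵇ-true e) (cong walk position))
        where
        regroup : ∀ s g → (suc s + g) + (suc s + g) ≡ suc (g + g) + suc (s + s)
        regroup s g = trans (dbl-+ (suc s) g) (trans (cong ((g + g) +_) (dbl-suc s)) (+-suc (g + g) (suc (s + s))))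
        position : i + i ≡ suc (g + g) + suc (s + s)
        position = trans (cong (λ z → z + z) (sym eg)) (regroup s g)

      b∉A : inA b ≡ true → ⊥
      b∉A h with exB-elim {i + i} h
      ... | t , lt , e with even-or-odd t
      ... | s , inj₁ refl with m≤n⇒∃[o]m+o≡n (≤-trans (<⇒≤ (dbl-<-inv {s} {i} lt)) (≤-pred i<k))
      ... | g , eg = reflect g (s + s) (trans (≡ᵇ-true e) (trans (sym bpos) (cong walk position)))
        where
        regroup : ∀ s g → suc ((s + g) + (s + g)) ≡ suc (g + g) + (s + s)
        regroup s g = cong suc (dbl-+ s g)
        position : suc (k0 + k0) ≡ suc (g + g) + (s + s)
        position = trans (cong (λ z → suc (z + z)) (sym eg)) (regroup s g)
      b∉A h | t , lt , e | s , inj₂ refl =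
        perMin s (<-≤-trans (odd-<-inv {s} {i} lt) (≤-pred i<k))
          (trans (w-odd s) (trans (cong p2 (≡ᵇ-true e)) p2b))

      b≢v : b ≢ v
      b≢v e with vAC
      ... | inj₁ x = b≢a (trans e x)
      ... | inj₂ x = b≢c (trans e x)

      adj-bv : adj b v ≡ true
      adj-bv with vAC
      ... | inj₁ x = subst (λ z → adj b z ≡ true) (sym x) ba
      ... | inj₂ x = subst (λ z → adj b z ≡ true) (sym x) bc

      inC : Fin n → Bool
      inC y = inA y ∨ ((y ≡ᵇ b) ∨ (y ≡ᵇ v))

      inC-A : ∀ {y} → inA y ≡ true → inC y ≡ true
      inC-A h = ∨-introˡ h
      inC-b : inC b ≡ true
      inC-b = ∨-introʳ {inA b} (∨-introˡ (≡ᵇ-refl b))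
      inC-v : inC v ≡ true
      inC-v = ∨-introʳ {inA v} (∨-introʳ {v ≡ᵇ b} (≡ᵇ-refl v))

      C-p2 : ∀ {y} → inC y ≡ true → inC (p2 y) ≡ true
      C-p2 {y} h with ∨-elim {inA y} h
      C-p2 {y} h | inj₂ h' with ∨-elim {y ≡ᵇ b} h'
      ... | inj₁ eb rewrite ≡ᵇ-true eb = inC-A (subst (λ z → inA z ≡ true) (sym p2b) d∈A)
      ... | inj₂ ev' rewrite ≡ᵇ-true ev' =
          inC-A (subst (λ z → inA z ≡ true) (trans (sym (w-odd' i')) (cong p2 (cong walk (sym (dbl-suc i')))))
                 (inA-intro (subst (suc (i' + i') <_) (sym (dbl-suc i')) ≤-refl)))
      C-p2 {y} h | inj₁ hA with exB-elim {i + i} hA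
      ... | t , lt , e with ≡ᵇ-true e | even-or-odd t
      ... | refl | zero , inj₁ refl = subst (λ z → inC z ≡ true) (sym p2d) inC-b
      ... | refl | suc s , inj₁ refl =
          inC-A (subst (λ z → inA z ≡ true) (trans (sym (w-odd' s)) (cong p2 (cong walk (sym (dbl-suc s)))))
            (inA-intro (<-trans (subst (suc (s + s) <_) (sym (dbl-suc s)) (≤-refl)) lt)))
      ... | refl | s , inj₂ refl with m≤n⇒m<n∨m≡n (odd-<-inv {s} {i} lt)
      ... | inj₁ ss<i = inC-A (subst (λ z → inA z ≡ true) (trans (cong walk (dbl-suc s)) (w-odd s))
                          (inA-intro (dbl-< {suc s} {i} ss<i)))
      ... | inj₂ refl = subst (λ z → inC z ≡ true) (trans (cong walk (dbl-suc s)) (w-odd s)) inC-v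

      q : Fin n → Fin n
      q y = if y ≡ᵇ b then v else (if y ≡ᵇ v then b else (if inA y then p1 y else p2 y))

      qb : q b ≡ v
      qb rewrite ≡ᵇ-refl b = refl
      qv : q v ≡ b
      qv rewrite ≡ᵇ-false (λ e → b≢v (sym e)) | ≡ᵇ-refl v = refl
      qA : ∀ {y} → inA y ≡ true → q y ≡ p1 y
      qA {y} h rewrite ≡ᵇ-false {x = y} {y = b} (λ { refl → b∉A h }) | ≡ᵇ-false {x = y} {y = v} (λ { refl → v∉A h }) | h = refl
      qO : ∀ {y} → inC y ≡ false → q y ≡ p2 y
      qO {y} h with inA y | y ≡ᵇ b | y ≡ᵇ v
      ... | false | false | false = refl

      classify : ∀ y → y ≡ b ⊎ (y ≡ v ⊎ (inA y ≡ true ⊎ inC y ≡ false))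
      classify y with bool-cases (y ≡ᵇ b) | bool-cases (y ≡ᵇ v) | bool-cases (inA y)
      ... | inj₁ e1 | _ | _ = inj₁ (≡ᵇ-true e1)
      ... | inj₂ _ | inj₁ e2 | _ = inj₂ (inj₁ (≡ᵇ-true e2))
      ... | inj₂ _ | inj₂ _ | inj₁ e3 = inj₂ (inj₂ (inj₁ e3))
      ... | inj₂ e1 | inj₂ e2 | inj₂ e3 = inj₂ (inj₂ (inj₂ outside))
        where outside : inC y ≡ false
              outside rewrite e1 | e2 | e3 = refl

      notC-p2 : ∀ {y} → W y ≡ true → inC y ≡ false → inC (p2 y) ≡ false
      notC-p2 {y} h hc with bool-cases (inC (p2 y))
      ... | inj₂ x = x
      ... | inj₁ x = ⊥-elim (t≢f (subst (λ z → inC z ≡ true) (p2p y h) (C-p2 x)) hc)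

      pmB : PM W adj
      pmB = record { p = q ; pW = qW ; pp = qq ; pne = qne ; padj = qadj }
        where
        qW : ∀ y → W y ≡ true → W (q y) ≡ true
        qW y h with classify y
        ... | inj₁ refl rewrite qb = walkW (i + i)
        ... | inj₂ (inj₁ refl) rewrite qv = Wb
        ... | inj₂ (inj₂ (inj₁ x)) rewrite qA x = p1W y h
        ... | inj₂ (inj₂ (inj₂ x)) rewrite qO x = p2W y h
        qq : ∀ y → W y ≡ true → q (q y) ≡ y
        qq y h with classify y
        ... | inj₁ refl rewrite qb = qv
        ... | inj₂ (inj₁ refl) rewrite qv = qb
        ... | inj₂ (inj₂ (inj₁ x)) rewrite qA x | qA (A-p1 x) = p1p y h
        ... | inj₂ (inj₂ (inj₂ x)) rewrite qO x | qO (notC-p2 h x) = p2p y h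
        qne : ∀ y → W y ≡ true → q y ≢ y
        qne y h with classify y
        ... | inj₁ refl rewrite qb = λ e → b≢v (sym e)
        ... | inj₂ (inj₁ refl) rewrite qv = b≢v
        ... | inj₂ (inj₂ (inj₁ x)) rewrite qA x = p1ne y h
        ... | inj₂ (inj₂ (inj₂ x)) rewrite qO x = p2ne y h
        qadj : ∀ y → W y ≡ true → adj y (q y) ≡ true
        qadj y h with classify y
        ... | inj₁ refl rewrite qb = adj-bv
        ... | inj₂ (inj₁ refl) rewrite qv = trans (sym-adj v b) adj-bv
        ... | inj₂ (inj₂ (inj₁ x)) rewrite qA x = plus-elim {adj = adj} {a = a} {c = c} (p1adj y h) (proj₁ (A-notAC x)) (proj₂ (A-notAC x))
        ... | inj₂ (inj₂ (inj₂ x)) rewrite qO x =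
            plus-elim {adj = adj} {a = b} {c = d} (p2adj y h) (λ { refl → t≢f inC-b x }) (λ { refl → t≢f (inC-A d∈A) x })

  result : PM W adj
  result with minimize (λ k → walk (suc (suc (k + k))) ≡ᵇ d) (proj₁ periodExists)
                (subst (λ z → (z ≡ᵇ d) ≡ true) (sym (proj₂ periodExists)) (≡ᵇ-refl d))
  ... | k0 , pk , _ , mn = go (search Q (suc k0))
    where
    open Main k0 (≡ᵇ-true pk) (λ j lt → ≡ᵇ-false⁻¹ (mn j lt))
    go : _ → PM W adj
    go (inj₂ none) = CaseA.pmA none
    go (inj₁ (zero , Q0 , _ , _)) with inAC-true Q0
    ... | inj₁ x = ⊥-elim (d≢a x)
    ... | inj₂ x = ⊥-elim (d≢c x)
    go (inj₁ (suc i' , Qi , lt , mnQ)) = CaseB.pmB i' Qi lt mnQ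

-- Tutte's theorem, in the form used here: a graph on W with symmetric adjacency
-- has a perfect matching or a barrier.  Proof by Lovász's method: induction on
-- the number of non-edges.  If some path a–b–c with ac missing has a vertex d
-- not adjacent to b, add ac resp. bd; a barrier for a larger graph is one for
-- the smaller, and two perfect matchings combine by the exchange step.
-- Otherwise "equal or adjacent" is an equivalence on the non-universal
-- vertices, its classes are cliques, and either the universal vertices form a
-- barrier or a perfect matching can be built directly.
module Tutte where

  open import Data.Nat using (ℕ; zero; suc; _+_; _≤_; _<_; z≤n; s≤s; _<?_)
  open import Data.Nat.Properties
  open import Data.Fin using (Fin)
  open import Data.Bool using (Bool; true; false; not; _∧_; _∨_; _xor_)
  open import Data.Bool.Properties using (not-involutive; ∧-zeroʳ; ∧-identityʳ)
  open import Data.Product using (Σ; _×_; _,_; proj₁; proj₂; ∃)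
  open import Data.Sum using (_⊎_; inj₁; inj₂)
  open import Data.Empty using (⊥; ⊥-elim)
  open import Relation.Nullary using (yes; no)
  open import Relation.Binary.PropositionalEquality
  open Booleans
  open FinSums
  open Matchings

  module _ {n : ℕ} where

    blockSize : (W S : Fin n → Bool) (lab : Fin n → Fin n) → Fin n → ℕ
    blockSize W S lab ℓ = count (λ x → W x ∧ (not (S x) ∧ (lab x ≡ᵇ ℓ)))

    qOdd : (W S : Fin n → Bool) (lab : Fin n → Fin n) → ℕ
    qOdd W S lab = count (λ ℓ → oddB (blockSize W S lab ℓ))

    -- A barrier: S ⊆ W and a labelling of W − S constant along edges (so each
    -- class is a union of components of W − S) with more odd classes than |S|.
    record Barrier (W : Fin n → Bool) (adj : Fin n → Fin n → Bool) : Set where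
      field
        S : Fin n → Bool
        lab : Fin n → Fin n
        S⊆W : ∀ x → S x ≡ true → W x ≡ true
        closed : ∀ x y → W x ≡ true → W y ≡ true → S x ≡ false → S y ≡ false → adj x y ≡ true → lab x ≡ lab y
        many : count S < qOdd W S lab

    barrier-weaken : ∀ {W} {adj adj' : Fin n → Fin n → Bool} →
      (∀ x y → adj x y ≡ true → adj' x y ≡ true) → Barrier W adj' → Barrier W adj
    barrier-weaken h β = record { S = S ; lab = lab ; S⊆W = S⊆W ; many = many
                                ; closed = λ x y wx wy sx sy axy → closed x y wx wy sx sy (h x y axy) }
      where open Barrier β

    oddBarrier : ∀ W adj → oddB (count W) ≡ true → Barrier W adj
    oddBarrier W adj odd = record
      { S = λ _ → false ; lab = λ _ → x₀ ; S⊆W = λ x () ; closed = λ _ _ _ _ _ _ _ → refl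
      ; many = subst (_< qOdd W (λ _ → false) (λ _ → x₀)) (sym (count-0 {n} {λ _ → false} (λ _ → refl)))
                 (count-≥1 (λ ℓ → oddB (blockSize W (λ _ → false) (λ _ → x₀) ℓ)) x₀ (trans (cong oddB wholeW) odd)) }
      where
      x₀ : Fin n
      x₀ = proj₁ (count-pos W (nonzero (count W) odd))
        where nonzero : ∀ k → oddB k ≡ true → 0 < k
              nonzero (suc k) _ = s≤s z≤n
      wholeW : blockSize W (λ _ → false) (λ _ → x₀) x₀ ≡ count W
      wholeW = count-cong λ z → trans (cong (W z ∧_) (≡ᵇ-refl x₀)) (∧-identityʳ (W z))

    blockParity-rm : ∀ W S lab x ℓ → oddB (blockSize W S lab ℓ) ≡
      ((W x ∧ (not (S x) ∧ (lab x ≡ᵇ ℓ))) xor oddB (blockSize (rm W x) S lab ℓ))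
    blockParity-rm W S lab x ℓ =
      trans (cong oddB (rm-count-∧ W (λ z → not (S z) ∧ (lab z ≡ᵇ ℓ)) x))
        (trans (oddB-+ (ind (W x ∧ (not (S x) ∧ (lab x ≡ᵇ ℓ)))) _)
               (cong (_xor oddB (blockSize (rm W x) S lab ℓ)) (oddB-ind (W x ∧ (not (S x) ∧ (lab x ≡ᵇ ℓ))))))

    blockParity-rm∉S : ∀ W S lab x ℓ → W x ≡ true → S x ≡ false →
      oddB (blockSize W S lab ℓ) ≡ ((lab x ≡ᵇ ℓ) xor oddB (blockSize (rm W x) S lab ℓ))
    blockParity-rm∉S W S lab x ℓ wx sx rewrite blockParity-rm W S lab x ℓ | wx | sx = refl

    blockParity-rm∈S : ∀ W S lab x ℓ → S x ≡ true →
      oddB (blockSize W S lab ℓ) ≡ oddB (blockSize (rm W x) S lab ℓ)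
    blockParity-rm∈S W S lab x ℓ sx rewrite blockParity-rm W S lab x ℓ | sx | ∧-zeroʳ (W x) = refl

    -- The saturated case.  Then W has a perfect matching: match two vertices
    -- of a class, or the last vertex of an odd class with a vertex of U, or two
    -- vertices of U, and recurse.
    module Saturated (adj : Fin n → Fin n → Bool) (sa : Sym adj) (U : Fin n → Bool) (lab : Fin n → Fin n) where

      record Good (W : Fin n → Bool) : Set where
        field
          univ : ∀ x y → W x ≡ true → W y ≡ true → U x ≡ true → x ≢ y → adj x y ≡ true
          clique : ∀ x y → W x ≡ true → W y ≡ true → U x ≡ false → U y ≡ false → lab x ≡ lab y → x ≢ y → adj x y ≡ true
          qle : qOdd W U lab ≤ count (λ x → W x ∧ U x)
          even : oddB (count W) ≡ false

      Rec : ℕ → Set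
      Rec k = (W' : Fin n → Bool) → count W' ≤ k → Good W' → PM W' adj

      removePair : ∀ {k W} → count W ≤ suc k → Good W → ∀ x y → W x ≡ true → W y ≡ true → x ≢ y → adj x y ≡ true →
        qOdd (rm (rm W x) y) U lab ≤ count (λ z → rm (rm W x) y z ∧ U z) → Rec k → PM W adj
      removePair {k} {W} le g x y wx wy x≢y axy qle rec =
        pm-extend sa x y wx wy x≢y axy (rec W₂ le₂ good₂)
        where
        W₂ = rm (rm W x) y
        c₁ : suc (count (rm W x)) ≡ count W
        c₁ = rm-count W x wx
        c₂ : suc (count W₂) ≡ count (rm W x)
        c₂ = rm-count (rm W x) y (rm-keep W x y wy (λ y≡x → x≢y (sym y≡x)))
        le₂ : count W₂ ≤ k
        le₂ = ≤-trans (n≤1+n _) (subst (_≤ k) (sym c₂) (≤-pred (subst (_≤ suc k) (sym c₁) le)))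
        sub₂ : ∀ z → W₂ z ≡ true → W z ≡ true
        sub₂ z h = rm-sub W x z (rm-sub (rm W x) y z h)
        good₂ : Good W₂
        good₂ = record
          { univ = λ a b wa wb → Good.univ g a b (sub₂ a wa) (sub₂ b wb)
          ; clique = λ a b wa wb → Good.clique g a b (sub₂ a wa) (sub₂ b wb)
          ; qle = qle
          ; even = trans (sym (oddB-+2 (count W₂))) (trans (cong oddB (trans (cong suc c₂) c₁)) (Good.even g)) }

      countU-rm² : ∀ W x y → count (λ z → W z ∧ U z) ≡
        ind (W x ∧ U x) + (ind (rm W x y ∧ U y) + count (λ z → rm (rm W x) y z ∧ U z))
      countU-rm² W x y = trans (rm-count-∧ W U x) (cong (ind (W x ∧ U x) +_) (rm-count-∧ (rm W x) U y))

      sameClass : (Fin n → Bool) → Fin n → Fin n → Bool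
      sameClass W x y = W x ∧ (W y ∧ (not (U x) ∧ (not (U y) ∧ ((lab x ≡ᵇ lab y) ∧ not (x ≡ᵇ y)))))

      sameClass-dec : ∀ W x y → sameClass W x y ≡ true →
        W x ≡ true × W y ≡ true × U x ≡ false × U y ≡ false × lab x ≡ lab y × x ≢ y
      sameClass-dec W x y h with W x | W y | U x | U y | lab x ≡ᵇ lab y in e1 | x ≡ᵇ y in e2
      ... | true | true | false | false | true | false = refl , refl , refl , refl , ≡ᵇ-true e1 , ≡ᵇ-false⁻¹ e2

      sameClass-intro : ∀ W x y → W x ≡ true → W y ≡ true → U x ≡ false → U y ≡ false → lab x ≡ lab y → x ≢ y →
        sameClass W x y ≡ true
      sameClass-intro W x y wx wy ux uy l x≢y rewrite wx | wy | ux | uy | l | ≡ᵇ-refl (lab y) | ≡ᵇ-false x≢y = refl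

      singleton : ∀ W → (∀ a b → sameClass W a b ≡ false) → ∀ x → W x ≡ true → U x ≡ false →
        blockSize W U lab (lab x) ≡ 1
      singleton W noPair x wx ux = count-unique _ x inClass only-x
        where
        inClass : (W x ∧ (not (U x) ∧ (lab x ≡ᵇ lab x))) ≡ true
        inClass rewrite wx | ux | ≡ᵇ-refl (lab x) = refl
        only-x : ∀ z → (W z ∧ (not (U z) ∧ (lab z ≡ᵇ lab x))) ≡ true → z ≡ x
        only-x z hz with fin-cases z x
        ... | inj₁ z≡x = z≡x
        ... | inj₂ z≢x = ⊥-elim (t≢f (sameClass-intro W z x (∧-true₁ hz) wx (not-true (∧-true₁ (∧-true₂ {W z} hz))) ux
                                        (≡ᵇ-true (∧-true₂ (∧-true₂ {W z} hz))) z≢x) (noPair z x))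

      matchInClass : ∀ {k W} → count W ≤ suc k → Good W → ∀ x y → sameClass W x y ≡ true → Rec k → PM W adj
      matchInClass {k} {W} le g x y hxy rec with sameClass-dec W x y hxy
      ... | wx , wy , ux , uy , lxy , x≢y =
        removePair le g x y wx wy x≢y (Good.clique g x y wx wy ux uy lxy x≢y) qle₂ rec
        where
        W₂ = rm (rm W x) y
        sameOdd : qOdd W₂ U lab ≡ qOdd W U lab
        sameOdd = count-cong λ ℓ → sym (begin
            oddB (blockSize W U lab ℓ)
          ≡⟨ blockParity-rm∉S W U lab x ℓ wx ux ⟩
            (lab x ≡ᵇ ℓ) xor oddB (blockSize (rm W x) U lab ℓ)
          ≡⟨ cong ((lab x ≡ᵇ ℓ) xor_) (blockParity-rm∉S (rm W x) U lab y ℓ (rm-keep W x y wy (λ y≡x → x≢y (sym y≡x))) uy) ⟩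
            (lab x ≡ᵇ ℓ) xor ((lab y ≡ᵇ ℓ) xor oddB (blockSize W₂ U lab ℓ))
          ≡⟨ cong (λ l → (lab x ≡ᵇ ℓ) xor ((l ≡ᵇ ℓ) xor oddB (blockSize W₂ U lab ℓ))) (sym lxy) ⟩
            (lab x ≡ᵇ ℓ) xor ((lab x ≡ᵇ ℓ) xor oddB (blockSize W₂ U lab ℓ))
          ≡⟨ xor-cancel (lab x ≡ᵇ ℓ) _ ⟩
            oddB (blockSize W₂ U lab ℓ) ∎)
          where open ≡-Reasoning
                xor-cancel : ∀ b r → (b xor (b xor r)) ≡ r
                xor-cancel true r = not-involutive r
                xor-cancel false r = refl
        sameU : count (λ z → W₂ z ∧ U z) ≡ count (λ z → W z ∧ U z)
        sameU rewrite countU-rm² W x y | ux | uy | ∧-zeroʳ (W x) | ∧-zeroʳ (rm W x y) = refl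
        qle₂ : qOdd W₂ U lab ≤ count (λ z → W₂ z ∧ U z)
        qle₂ = subst₂ _≤_ (sym sameOdd) (sym sameU) (Good.qle g)

      matchWithU : ∀ {k W} → count W ≤ suc k → Good W → ∀ x → W x ≡ true → U x ≡ false →
        blockSize W U lab (lab x) ≡ 1 → Rec k → PM W adj
      matchWithU {k} {W} le g x wx ux single rec = withU (count-pos (λ z → W z ∧ U z) (≤-trans someOdd (Good.qle g)))
        where
        someOdd : 1 ≤ qOdd W U lab
        someOdd = count-≥1 (λ ℓ → oddB (blockSize W U lab ℓ)) (lab x) (cong oddB single)
        withU : ∃ (λ u → (W u ∧ U u) ≡ true) → PM W adj
        withU (u , hu) = removePair le g x u wx wu x≢u axu qle₂ rec
          where
          wu = ∧-true₁ hu
          uu = ∧-true₂ {W u} hu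
          x≢u : x ≢ u
          x≢u refl = t≢f uu ux
          axu : adj x u ≡ true
          axu = trans (sa x u) (Good.univ g u x wu wx uu (λ u≡x → x≢u (sym u≡x)))
          W₂ = rm (rm W x) u
          lessU : suc (count (λ z → W₂ z ∧ U z)) ≡ count (λ z → W z ∧ U z)
          lessU rewrite countU-rm² W x u | ux | uu | ∧-zeroʳ (W x) | rm-keep W x u wu (λ u≡x → x≢u (sym u≡x)) = refl
          parity : ∀ ℓ → oddB (blockSize W U lab ℓ) ≡ ((lab x ≡ᵇ ℓ) xor oddB (blockSize W₂ U lab ℓ))
          parity ℓ = trans (blockParity-rm∉S W U lab x ℓ wx ux) (cong ((lab x ≡ᵇ ℓ) xor_) (blockParity-rm∈S (rm W x) U lab u ℓ uu))
          nowEven : oddB (blockSize W₂ U lab (lab x)) ≡ false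
          nowEven with oddB (blockSize W₂ U lab (lab x)) | parity (lab x)
          ... | false | _ = refl
          ... | true | e rewrite single | ≡ᵇ-refl (lab x) = ⊥-elim (t≢f refl e)
          lessOdd : suc (qOdd W₂ U lab) ≡ qOdd W U lab
          lessOdd = count-change (λ ℓ → oddB (blockSize W U lab ℓ)) (λ ℓ → oddB (blockSize W₂ U lab ℓ)) (lab x)
                      (cong oddB single) nowEven
                      (λ ℓ ℓ≢ → trans (parity ℓ) (cong (_xor oddB (blockSize W₂ U lab ℓ)) (≡ᵇ-false (λ e → ℓ≢ (sym e)))))
          qle₂ : qOdd W₂ U lab ≤ count (λ z → W₂ z ∧ U z)
          qle₂ = ≤-pred (subst₂ _≤_ (sym lessOdd) (sym lessU) (Good.qle g))

      matchInU : ∀ {k W} → count W ≤ suc k → Good W → (∀ z → W z ≡ true → U z ≡ true) → Rec k → PM W adj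
      matchInU {k} {W} le g allU rec with bool-cases (anyF W)
      ... | inj₂ empty = pm-empty (anyF-false W empty)
      ... | inj₁ nonempty with anyF-elim W nonempty
      ... | u , wu with bool-cases (anyF (rm W u))
      ... | inj₂ onlyU = ⊥-elim (t≢f odd (Good.even g))
        where odd : oddB (count W) ≡ true
              odd = cong oddB (trans (sym (rm-count W u wu)) (cong suc (count-0 (anyF-false (rm W u) onlyU))))
      ... | inj₁ more with anyF-elim _ more
      ... | u' , hu' = removePair le g u u' wu wu' u≢u' (Good.univ g u u' wu wu' (allU u wu) u≢u') qle₂ rec
        where
        wu' = rm-sub W u u' hu'
        u≢u' : u ≢ u'
        u≢u' u≡u' = rm-ne W u u' hu' (sym u≡u')
        W₂ = rm (rm W u) u'
        noClass : ∀ ℓ z → (W₂ z ∧ (not (U z) ∧ (lab z ≡ᵇ ℓ))) ≡ false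
        noClass ℓ z with bool-cases (W₂ z)
        ... | inj₂ e rewrite e = refl
        ... | inj₁ e rewrite e | allU z (rm-sub W u z (rm-sub (rm W u) u' z e)) = refl
        qle₂ : qOdd W₂ U lab ≤ count (λ z → W₂ z ∧ U z)
        qle₂ = subst (_≤ count (λ z → W₂ z ∧ U z)) (sym (count-0 (λ ℓ → cong oddB (count-0 (noClass ℓ))))) z≤n

      saturatedPM : ∀ k W → count W ≤ k → Good W → PM W adj
      saturatedPM zero W le g = pm-empty (count-0-inv W (n≤0⇒n≡0 le))
      saturatedPM (suc k) W le g with bool-cases (anyF (λ x → anyF (λ y → sameClass W x y)))
      ... | inj₁ somePair with anyF-elim _ somePair
      ...   | x , hx with anyF-elim _ hx
      ...     | y , hxy = matchInClass le g x y hxy (saturatedPM k)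
      saturatedPM (suc k) W le g | inj₂ noPair' with bool-cases (anyF (λ x → W x ∧ not (U x)))
      ... | inj₁ someOutside with anyF-elim _ someOutside
      ...   | x , hx = matchWithU le g x (∧-true₁ hx) ux (singleton W noPair x (∧-true₁ hx) ux) (saturatedPM k)
        where
        noPair : ∀ a b → sameClass W a b ≡ false
        noPair a b = anyF-false _ (anyF-false _ noPair' a) b
        ux = not-true (∧-true₂ {W x} hx)
      saturatedPM (suc k) W le g | inj₂ noPair' | inj₂ noneOutside = matchInU le g allU (saturatedPM k)
        where
        allU : ∀ z → W z ≡ true → U z ≡ true
        allU z wz with bool-cases (U z)
        ... | inj₁ e = e
        ... | inj₂ e = ⊥-elim (t≢f (∧-intro wz (not-false e)) (anyF-false _ noneOutside z))

    record ExchangeConfig (W : Fin n → Bool) (adj : Fin n → Fin n → Bool) (a b c d : Fin n) : Set where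
      field
        wa : W a ≡ true
        wb : W b ≡ true
        wc : W c ≡ true
        wd : W d ≡ true
        ab : adj a b ≡ true
        bc : adj b c ≡ true
        ac : adj a c ≡ false
        a≢c : a ≢ c
        bd : adj b d ≡ false
        b≢d : b ≢ d
        a≢b : a ≢ b
        b≢c : b ≢ c

    isExchangeConfig : (W : Fin n → Bool) (adj : Fin n → Fin n → Bool) → Fin n → Fin n → Fin n → Fin n → Bool
    isExchangeConfig W adj a b c d =
      W a ∧ (W b ∧ (W c ∧ (W d ∧ (adj a b ∧ (adj b c ∧ (not (adj a c) ∧ (not (a ≡ᵇ c) ∧
      (not (adj b d) ∧ (not (b ≡ᵇ d) ∧ (not (a ≡ᵇ b) ∧ not (b ≡ᵇ c)))))))))))

    isExchangeConfig-dec : ∀ W adj a b c d → isExchangeConfig W adj a b c d ≡ true → ExchangeConfig W adj a b c d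
    isExchangeConfig-dec W adj a b c d h
      with W a in q1 | W b in q2 | W c in q3 | W d in q4 | adj a b in q5 | adj b c in q6 | adj a c in q7
         | a ≡ᵇ c in e1 | adj b d in q8 | b ≡ᵇ d in e2 | a ≡ᵇ b in e3 | b ≡ᵇ c in e4
    ... | true | true | true | true | true | true | false | false | false | false | false | false =
      record { wa = q1 ; wb = q2 ; wc = q3 ; wd = q4 ; ab = q5 ; bc = q6 ; ac = q7
             ; a≢c = ≡ᵇ-false⁻¹ e1 ; bd = q8 ; b≢d = ≡ᵇ-false⁻¹ e2 ; a≢b = ≡ᵇ-false⁻¹ e3 ; b≢c = ≡ᵇ-false⁻¹ e4 }

    isExchangeConfig-intro : ∀ {W adj a b c d} → ExchangeConfig W adj a b c d → isExchangeConfig W adj a b c d ≡ true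
    isExchangeConfig-intro record { wa = wa ; wb = wb ; wc = wc ; wd = wd ; ab = ab ; bc = bc ; ac = ac ; a≢c = a≢c
                                  ; bd = bd ; b≢d = b≢d ; a≢b = a≢b ; b≢c = b≢c }
      rewrite wa | wb | wc | wd | ab | bc | ac | bd | ≡ᵇ-false a≢c | ≡ᵇ-false b≢d | ≡ᵇ-false a≢b | ≡ᵇ-false b≢c = refl

    findExchangeConfig : ∀ W adj →
      (Σ (Fin n) λ a → Σ (Fin n) λ b → Σ (Fin n) λ c → Σ (Fin n) λ d → ExchangeConfig W adj a b c d)
      ⊎ (∀ a b c d → isExchangeConfig W adj a b c d ≡ false)
    findExchangeConfig W adj with bool-cases (anyF λ a → anyF λ b → anyF λ c → anyF λ d → isExchangeConfig W adj a b c d)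
    ... | inj₁ h with anyF-elim _ h
    ...   | a , ha with anyF-elim _ ha
    ...     | b , hb with anyF-elim _ hb
    ...       | c , hc with anyF-elim _ hc
    ...         | d , hd = inj₁ (a , b , c , d , isExchangeConfig-dec W adj a b c d hd)
    findExchangeConfig W adj | inj₂ h =
      inj₂ λ a b c d → anyF-false _ (anyF-false _ (anyF-false _ (anyF-false _ h a) b) c) d

    combineExchange : ∀ {W adj} → Sym adj → ∀ {a b c d} → ExchangeConfig W adj a b c d →
      PM W (adjPlus adj a c) ⊎ Barrier W (adjPlus adj a c) →
      PM W (adjPlus adj b d) ⊎ Barrier W (adjPlus adj b d) → PM W adj ⊎ Barrier W adj
    combineExchange {W} {adj} sa {a} {b} {c} {d} D r₁ r₂ = go r₁ r₂
      where
      open ExchangeConfig D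
      ba : adj b a ≡ true
      ba = trans (sa b a) ab
      d≢a : d ≢ a
      d≢a d≡a = t≢f ba (subst (λ z → adj b z ≡ false) d≡a bd)
      d≢c : d ≢ c
      d≢c d≡c = t≢f bc (subst (λ z → adj b z ≡ false) d≡c bd)
      go : PM W (adjPlus adj a c) ⊎ Barrier W (adjPlus adj a c) →
           PM W (adjPlus adj b d) ⊎ Barrier W (adjPlus adj b d) → PM W adj ⊎ Barrier W adj
      go (inj₂ β) _ = inj₂ (barrier-weaken (λ x y → plus-weak {adj = adj} {a = a} {c = c}) β)
      go (inj₁ pm₁) _ with fin-cases (PM.p pm₁ a) c
      go (inj₁ pm₁) _ | inj₂ p₁a≢c = inj₁ (pm-demote pm₁ wc p₁a≢c)
      go (inj₁ pm₁) (inj₂ β) | inj₁ _ = inj₂ (barrier-weaken (λ x y → plus-weak {adj = adj} {a = b} {c = d}) β)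
      go (inj₁ pm₁) (inj₁ pm₂) | inj₁ p₁a with fin-cases (PM.p pm₂ b) d
      ... | inj₂ p₂b≢d = inj₁ (pm-demote pm₂ wd p₂b≢d)
      ... | inj₁ p₂b = inj₁ (Exchange.result W adj sa a b c d wa wb wc wd ba bc (λ b≡a → a≢b (sym b≡a)) b≢c d≢a d≢c
                                             pm₁ p₁a pm₂ p₂b)

    -- Without exchange configurations: U = vertices adjacent to all of W, and
    -- "equal or adjacent" is an equivalence on W − U; lab picks the first element
    -- of each class.  If |U| < #odd classes, U is a barrier; otherwise Good holds.
    module NoExchange (W : Fin n → Bool) (adj : Fin n → Fin n → Bool) (sa : Sym adj) (even : oddB (count W) ≡ false)
                      (noConfig : ∀ a b c d → isExchangeConfig W adj a b c d ≡ false) where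
      adjacentOrOutside : Fin n → Fin n → Bool
      adjacentOrOutside x y = not (W y) ∨ ((y ≡ᵇ x) ∨ adj x y)

      U : Fin n → Bool
      U x = W x ∧ allF (adjacentOrOutside x)

      NU : Fin n → Bool
      NU x = W x ∧ not (U x)

      rel : Fin n → Fin n → Bool
      rel x y = (x ≡ᵇ y) ∨ adj x y

      rel-refl : ∀ x → rel x x ≡ true
      rel-refl x rewrite ≡ᵇ-refl x = refl

      rel-adj : ∀ {x y} → rel x y ≡ true → x ≢ y → adj x y ≡ true
      rel-adj {x} {y} r x≢y rewrite ≡ᵇ-false x≢y = r

      adj-rel : ∀ {x y} → adj x y ≡ true → rel x y ≡ true
      adj-rel {x} {y} a = ∨-introʳ {x ≡ᵇ y} a

      rel-sym : ∀ {x y} → rel x y ≡ true → rel y x ≡ true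
      rel-sym {x} {y} r with fin-cases x y
      ... | inj₁ refl = rel-refl x
      ... | inj₂ x≢y = adj-rel (trans (sa y x) (rel-adj r x≢y))

      NU-W : ∀ {x} → NU x ≡ true → W x ≡ true
      NU-W h = ∧-true₁ h

      NU-U : ∀ {x} → NU x ≡ true → U x ≡ false
      NU-U {x} h = not-true (∧-true₂ {W x} h)

      NU-intro : ∀ {x} → W x ≡ true → U x ≡ false → NU x ≡ true
      NU-intro wx ux rewrite wx | ux = refl

      nonNeighbour : ∀ {y} → NU y ≡ true → ∃ λ d → W d ≡ true × d ≢ y × adj y d ≡ false
      nonNeighbour {y} ny with allF-false (adjacentOrOutside y) (subst (λ w → (w ∧ allF (adjacentOrOutside y)) ≡ false) (NU-W ny) (NU-U ny))
      ... | d , h with W d in q1 | d ≡ᵇ y in q2 | adj y d in q3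
      nonNeighbour {y} ny | d , () | false | _ | _
      nonNeighbour {y} ny | d , () | true | true | _
      nonNeighbour {y} ny | d , () | true | false | true
      nonNeighbour {y} ny | d , refl | true | false | false = d , q1 , ≡ᵇ-false⁻¹ q2 , q3

      -- transitivity through a non-universal middle vertex, else an exchange configuration
      rel-trans : ∀ x y z → W x ≡ true → NU y ≡ true → W z ≡ true → rel x y ≡ true → rel y z ≡ true → rel x z ≡ true
      rel-trans x y z wx ny wz rxy ryz with fin-cases x y | fin-cases y z | fin-cases x z
      ... | inj₁ refl | _ | _ = ryz
      ... | inj₂ _ | inj₁ refl | _ = rxy
      ... | inj₂ _ | inj₂ _ | inj₁ refl = rel-refl x
      ... | inj₂ x≢y | inj₂ y≢z | inj₂ x≢z with bool-cases (adj x z) | nonNeighbour ny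
      ...   | inj₁ axz | _ = adj-rel axz
      ...   | inj₂ axz | d , wd , d≢y , ayd =
        ⊥-elim (t≢f (isExchangeConfig-intro {W} {adj} {x} {y} {z} {d}
                       (record { wa = wx ; wb = NU-W ny ; wc = wz ; wd = wd ; ab = rel-adj rxy x≢y ; bc = rel-adj ryz y≢z
                               ; ac = axz ; a≢c = x≢z ; bd = ayd ; b≢d = λ y≡d → d≢y (sym y≡d) ; a≢b = x≢y ; b≢c = y≢z }))
                    (noConfig x y z d))

      lab : Fin n → Fin n
      lab x = fromMaybe x (firstM (λ z → NU z ∧ rel x z))

      lab-spec : ∀ x → NU x ≡ true → NU (lab x) ≡ true × rel x (lab x) ≡ true
      lab-spec x nx with firstM-some (λ z → NU z ∧ rel x z) x (∧-intro nx (rel-refl x))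
      ... | w , e with firstM-sound (λ z → NU z ∧ rel x z) e
      ... | pw rewrite e = ∧-true₁ pw , ∧-true₂ {NU w} pw

      lab-eq : ∀ x y → NU x ≡ true → NU y ≡ true → rel x y ≡ true → lab x ≡ lab y
      lab-eq x y nx ny rxy with firstM-some (λ z → NU z ∧ rel x z) x (∧-intro nx (rel-refl x))
      ... | w , e = trans (cong (fromMaybe x) e) (sym (cong (fromMaybe y) (trans (sym (firstM-cong sameRelated)) e)))
        where
        sameRelated : ∀ z → (NU z ∧ rel x z) ≡ (NU z ∧ rel y z)
        sameRelated z with bool-cases (NU z)
        ... | inj₂ e rewrite e = refl
        ... | inj₁ e rewrite e = bool-iff
                (λ r → rel-trans y x z (NU-W ny) nx (NU-W e) (rel-sym rxy) r)
                (λ r → rel-trans x y z (NU-W nx) ny (NU-W e) rxy r)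

      univ : ∀ x y → W x ≡ true → W y ≡ true → U x ≡ true → x ≢ y → adj x y ≡ true
      univ x y wx wy ux x≢y with allF-elim (adjacentOrOutside x) (∧-true₂ {W x} ux) y
      ... | h rewrite wy | ≡ᵇ-false (λ y≡x → x≢y (sym y≡x)) = h

      clique : ∀ x y → W x ≡ true → W y ≡ true → U x ≡ false → U y ≡ false → lab x ≡ lab y → x ≢ y → adj x y ≡ true
      clique x y wx wy ux uy l x≢y = rel-adj (rel-trans x (lab x) y wx (proj₁ sx) wy (proj₂ sx)
                                       (rel-sym (subst (λ z → rel y z ≡ true) (sym l) (proj₂ sy)))) x≢y
        where sx = lab-spec x (NU-intro wx ux)
              sy = lab-spec y (NU-intro wy uy)

      result : PM W adj ⊎ Barrier W adj
      result with count U <? qOdd W U lab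
      ... | yes lt = inj₂ (record { S = U ; lab = lab ; S⊆W = λ x ux → ∧-true₁ ux ; many = lt
                                  ; closed = λ x y wx wy ux uy axy → lab-eq x y (NU-intro wx ux) (NU-intro wy uy) (adj-rel axy) })
      ... | no nlt = inj₁ (Saturated.saturatedPM adj sa U lab (count W) W ≤-refl
                       (record { univ = univ ; clique = clique ; even = even
                               ; qle = subst (qOdd W U lab ≤_) (sym |U∩W|≡|U|) (≮⇒≥ nlt) }))
        where |U∩W|≡|U| : count (λ x → W x ∧ U x) ≡ count U
              |U∩W|≡|U| = count-cong λ x → idem (W x)
                where idem : ∀ w {r} → (w ∧ (w ∧ r)) ≡ (w ∧ r)
                      idem true = refl
                      idem false = refl

    tutte : ∀ μ W adj → Sym adj → nonEdges W adj ≤ μ → PM W adj ⊎ Barrier W adj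
    tutte μ W adj sa le with bool-cases (oddB (count W))
    ... | inj₁ odd = inj₂ (oddBarrier W adj odd)
    ... | inj₂ even with findExchangeConfig W adj
    ... | inj₂ none = NoExchange.result W adj sa even none
    ... | inj₁ (a , b , c , d , D) = exchange μ le
      where
      open ExchangeConfig D
      fewer-ac = nonEdges-dec W adj a c wa wc ac
      fewer-bd = nonEdges-dec W adj b d wb wd bd
      exchange : ∀ μ → nonEdges W adj ≤ μ → PM W adj ⊎ Barrier W adj
      exchange zero le = ⊥-elim (1+n≰0 (≤-trans fewer-ac le))
        where 1+n≰0 : ∀ {k} → suc k ≤ 0 → ⊥
              1+n≰0 ()
      exchange (suc μ') le = combineExchange sa D
         (tutte μ' W (adjPlus adj a c) (plus-sym sa a c) (≤-pred (≤-trans fewer-ac le)))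
         (tutte μ' W (adjPlus adj b d) (plus-sym sa b d) (≤-pred (≤-trans fewer-bd le)))

-- Incidence counting in a multigraph G: every edge has two distinct ends, so
-- summing degrees over a vertex set K counts edge ends in K (double counting).
-- In a cubic graph this gives 3|K| = 2 e(K) + |∂K| and |V(G)| even, and a
-- perfect matching M covers |K| = number of ends of M-edges in K.
module Handshake (G : Multigraph) where

  open import Data.Nat using (ℕ; _+_; _*_)
  open import Data.Fin using (Fin)
  open import Data.Bool using (Bool; true; false; not; _∧_; _xor_)
  open import Data.Bool.Properties using (∧-comm; ∧-zeroʳ; ∧-identityʳ)
  open import Data.Sum using (_⊎_; inj₁; inj₂)
  open import Function using (_∘_)
  open import Relation.Binary.PropositionalEquality
  open Booleans
  open FinSums

  open Multigraph G

  e1 e2 : Fin m → Fin n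
  e1 = end₁ G
  e2 = end₂ G

  e1≢e2 : ∀ g → e1 g ≢ e2 g
  e1≢e2 = loopless

  inc1 : ∀ g → incident G g (e1 g) ≡ true
  inc1 g rewrite ≡ᵇ-refl (e1 g) = refl

  inc2 : ∀ g → incident G g (e2 g) ≡ true
  inc2 g = ∨-introʳ {e1 g ≡ᵇ e2 g} (≡ᵇ-refl (e2 g))

  inc-ends : ∀ {g w} → incident G g w ≡ true → e1 g ≡ w ⊎ e2 g ≡ w
  inc-ends {g} {w} h with ∨-elim {e1 g ≡ᵇ w} h
  ... | inj₁ x = inj₁ (≡ᵇ-true x)
  ... | inj₂ x = inj₂ (≡ᵇ-true x)

  endsIn : (Fin n → Bool) → Fin m → ℕ
  endsIn K g = ind (K (e1 g)) + ind (K (e2 g))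

  inside : (Fin n → Bool) → Fin m → Bool
  inside K g = K (e1 g) ∧ K (e2 g)

  eIn : (Fin n → Bool) → ℕ
  eIn K = count (inside K)

  cut : (Fin n → Bool) → ℕ
  cut K = count (λ g → K (e1 g) xor K (e2 g))

  cut-not : ∀ (K : Fin n → Bool) → cut (not ∘ K) ≡ cut K
  cut-not K = count-cong λ g → not-xor (K (e1 g)) (K (e2 g))
    where
    not-xor : ∀ a b → (not a xor not b) ≡ (a xor b)
    not-xor true true = refl
    not-xor true false = refl
    not-xor false true = refl
    not-xor false false = refl

  doubleCount : ∀ (K : Fin n → Bool) (P : Fin m → Bool) →
    Σ' (λ v → count (λ g → K v ∧ (P g ∧ incident G g v))) ≡ Σ' (λ g → ind (P g ∧ K (e1 g)) + ind (P g ∧ K (e2 g)))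
  doubleCount K P = trans (Σ'-swap (λ v g → ind (K v ∧ (P g ∧ incident G g v)))) (Σ'-cong perEdge)
    where
    perEdge : ∀ g → Σ' (λ v → ind (K v ∧ (P g ∧ incident G g v))) ≡ ind (P g ∧ K (e1 g)) + ind (P g ∧ K (e2 g))
    perEdge g = trans (Σ'-two _ (e1 g) (e2 g) (e1≢e2 g) elsewhere) (cong₂ _+_ (cong ind (atEnd (inc1 g))) (cong ind (atEnd (inc2 g))))
      where
      elsewhere : ∀ v → v ≢ e1 g → v ≢ e2 g → ind (K v ∧ (P g ∧ incident G g v)) ≡ 0
      elsewhere v v≢1 v≢2 rewrite ≡ᵇ-false (λ e → v≢1 (sym e)) | ≡ᵇ-false (λ e → v≢2 (sym e)) | ∧-zeroʳ (P g) | ∧-zeroʳ (K v) = refl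
      atEnd : ∀ {v} → incident G g v ≡ true → (K v ∧ (P g ∧ incident G g v)) ≡ (P g ∧ K v)
      atEnd {v} h rewrite h | ∧-identityʳ (P g) = ∧-comm (K v) (P g)

  Σ'-plus2 : ∀ (h : Fin m → ℕ) (a : Fin m) → Σ' (λ g → h g + 2 * ind (g ≡ᵇ a)) ≡ Σ' h + 2
  Σ'-plus2 h a = trans (Σ'-+ h (λ g → 2 * ind (g ≡ᵇ a))) (cong (Σ' h +_) (trans (Σ'-*ˡ 2 (λ g → ind (g ≡ᵇ a))) (cong (2 *_) (Σ'-indicator a))))

  module Cubic-facts (cubic : Cubic G) where

    deg3 : ∀ v → count (λ g → incident G g v) ≡ 3
    deg3 v = trans (sym (len-filter (λ g → incident G g v))) (cubic v)

    handshake : ∀ K → count K * 3 ≡ Σ' (endsIn K)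
    handshake K = trans (sym (Σ'-*ʳ (λ v → ind (K v)) 3)) (trans (Σ'-cong degrees) (doubleCount K (λ _ → true)))
      where
      degrees : ∀ v → ind (K v) * 3 ≡ count (λ g → K v ∧ (true ∧ incident G g v))
      degrees v with K v
      ... | true = sym (deg3 v)
      ... | false = sym (count-0 {m} (λ _ → refl))

    handshake-cut : ∀ (K : Fin n → Bool) → count K * 3 ≡ 2 * eIn K + cut K
    handshake-cut K = trans (handshake K) (trans (Σ'-cong split)
       (trans (Σ'-+ (λ g → 2 * ind (inside K g)) (λ g → ind (K (e1 g) xor K (e2 g))))
              (cong (_+ cut K) (Σ'-*ˡ 2 (λ g → ind (inside K g))))))
      where
      split : ∀ g → endsIn K g ≡ 2 * ind (inside K g) + ind (K (e1 g) xor K (e2 g))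
      split g with K (e1 g) | K (e2 g)
      ... | true | true = refl
      ... | true | false = refl
      ... | false | true = refl
      ... | false | false = refl

    n-even : oddB n ≡ false
    n-even = begin
        oddB n                          ≡⟨ sym (oddB-*3 n) ⟩
        oddB (n * 3)                    ≡⟨ cong (λ k → oddB (k * 3)) (sym (count-true {n})) ⟩
        oddB (count {n} (λ _ → true) * 3) ≡⟨ cong oddB (handshake (λ _ → true)) ⟩
        oddB (Σ' {m} (λ _ → 2))         ≡⟨ cong oddB (Σ'-*ˡ {m} 2 (λ _ → 1)) ⟩
        oddB (2 * count {m} (λ _ → true)) ≡⟨ oddB-2* (count {m} (λ _ → true)) ⟩
        false                           ∎
      where open ≡-Reasoning

  matchedEnds : ∀ (M : Fin m → Bool) → PerfectMatching G M → ∀ K →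
    count K ≡ Σ' (λ g → ind (M g ∧ K (e1 g)) + ind (M g ∧ K (e2 g)))
  matchedEnds M pm K = trans (Σ'-cong covered) (doubleCount K M)
    where
    covered : ∀ v → ind (K v) ≡ count (λ g → K v ∧ (M g ∧ incident G g v))
    covered v with K v
    ... | true = sym (trans (sym (len-filter (λ g → M g ∧ incident G g v))) (pm v))
    ... | false = sym (count-0 {m} (λ _ → refl))

-- Cycles in induced subgraphs.  A walk in K that never immediately reuses its
-- last edge must repeat a vertex; the part between the first repetition and
-- its earlier occurrence is a cycle.  Such walks exist when every vertex of K
-- has at least two edges inside K; deleting vertices of smaller inner degree
-- one at a time shows that any nonempty K with |K| ≤ e(K) contains a cycle.
module Cycles (G : Multigraph) where

  open import Data.Nat using (ℕ; zero; suc; _+_; _≤_; _<_; z≤n; s≤s; _%_)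
  open import Data.Nat.Properties
  open import Data.Nat.DivMod using (m<n⇒m%n≡m; n%n≡0)
  open import Data.Fin using (Fin; toℕ)
  open import Data.Fin.Properties using (toℕ-injective; toℕ<n; pigeonhole)
  open import Data.Bool using (Bool; true; false; _∧_; if_then_else_)
  open import Data.Product using (_×_; _,_; proj₁; proj₂; ∃)
  open import Data.Product.Properties using (,-injective)
  open import Data.Sum using (_⊎_; inj₁; inj₂)
  open import Data.Empty using (⊥; ⊥-elim)
  open import Relation.Binary.PropositionalEquality
  open import Relation.Binary.Definitions using (tri<; tri≈; tri>)
  open Booleans
  open FinSums
  open NatSearch
  open Handshake G using (e1; e2; e1≢e2; inc1; inc2; inside; eIn)

  open Multigraph G

  joins-unique : ∀ {g a b c d} → Joins G g a b → Joins G g c d → (a ≡ c × b ≡ d) ⊎ (a ≡ d × b ≡ c)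
  joins-unique (inj₁ x) (inj₁ y) with ,-injective (trans (sym x) y)
  ... | p , q = inj₁ (p , q)
  joins-unique (inj₁ x) (inj₂ y) with ,-injective (trans (sym x) y)
  ... | p , q = inj₂ (p , q)
  joins-unique (inj₂ x) (inj₁ y) with ,-injective (trans (sym x) y)
  ... | p , q = inj₂ (q , p)
  joins-unique (inj₂ x) (inj₂ y) with ,-injective (trans (sym x) y)
  ... | p , q = inj₁ (q , p)

  joins-ne : ∀ {g a b} → Joins G g a b → a ≢ b
  joins-ne {g} (inj₁ x) refl = e1≢e2 g (trans (cong proj₁ x) (sym (cong proj₂ x)))
  joins-ne {g} (inj₂ x) refl = e1≢e2 g (trans (cong proj₁ x) (sym (cong proj₂ x)))

  module Extract (A : Fin n → Bool) (Z : ℕ → Fin n) (H : ℕ → Fin m)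
    (joinsF : ∀ t → Joins G (H (suc t)) (Z t) (Z (suc t)))
    (hne : ∀ t → H (suc (suc t)) ≢ H (suc t))
    (AZ : ∀ t → A (Z t) ≡ true) where

    Rep : ℕ → Bool
    Rep j = exB j (λ i → Z i ≡ᵇ Z j)

    someRep : ∃ λ j → Rep j ≡ true
    someRep with pigeonhole (n<1+n n) (λ (k : Fin (suc n)) → Z (toℕ k))
    ... | i , j , i<j , e = toℕ j , exB-intro {P = λ i → Z i ≡ᵇ Z (toℕ j)} i<j (subst (λ z → (z ≡ᵇ Z (toℕ j)) ≡ true) (sym e) (≡ᵇ-refl _))

    module FirstRepeat (j : ℕ) (repj : Rep j ≡ true) (minRep : ∀ j' → j' < j → Rep j' ≡ false)
             (i : ℕ) (i<j : i < j) (Zij : Z i ≡ Z j) where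
      distinct : ∀ s t → s < t → t < j → Z s ≢ Z t
      distinct s t s<t t<j e = t≢f (exB-intro {P = λ i → Z i ≡ᵇ Z t} s<t (subst (λ z → (z ≡ᵇ Z t) ≡ true) (sym e) (≡ᵇ-refl _))) (minRep t t<j)

      module Segment (jj : ℕ) (jeq : i + suc (suc jj) ≡ j) where
        L : ℕ
        L = suc (suc jj)

        idx< : ∀ (k : Fin L) → i + toℕ k < j
        idx< k = subst (i + toℕ k <_) jeq (+-monoʳ-< i (toℕ<n k))

        vs : Fin L → Fin n
        vs k = Z (i + toℕ k)
        es : Fin L → Fin m
        es k = H (suc (i + toℕ k))

        dist' : ∀ s t → s < j → t < j → Z s ≡ Z t → s ≡ t
        dist' s t sj tj e with <-cmp s t
        ... | tri< lt _ _ = ⊥-elim (distinct s t lt tj e)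
        ... | tri≈ _ eq _ = eq
        ... | tri> _ _ gt = ⊥-elim (distinct t s gt sj (sym e))

        vs-inj : ∀ {k1 k2} → vs k1 ≡ vs k2 → k1 ≡ k2
        vs-inj {k1} {k2} e = toℕ-injective (+-cancelˡ-≡ i _ _ (dist' _ _ (idx< k1) (idx< k2) e))

        -- the edges of the segment are distinct; otherwise a vertex repeats
        -- before j, or the walk backtracks
        esne : ∀ s1 s2 → i ≤ s1 → s1 < s2 → s2 < j → H (suc s1) ≢ H (suc s2)
        esne s1 s2 i≤s1 s1<s2 s2<j eg with joins-unique (joinsF s1) (subst (λ g → Joins G g (Z s2) (Z (suc s2))) (sym eg) (joinsF s2))
        ... | inj₁ (p , _) = distinct s1 s2 s1<s2 s2<j p
        ... | inj₂ (p , q) with m≤n⇒m<n∨m≡n s2<j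
        ... | inj₁ ss2<j = distinct s1 (suc s2) (<-trans s1<s2 (n<1+n s2)) ss2<j p
        ... | inj₂ ss2≡j with m≤n⇒m<n∨m≡n i≤s1
        ... | inj₁ i<s1 = distinct i s1 i<s1 (<-trans s1<s2 s2<j) (trans Zij (trans (sym (cong Z ss2≡j)) (sym p)))
        ... | inj₂ refl with m≤n⇒m<n∨m≡n s1<s2
        ... | inj₁ si<s2 = distinct (suc i) s2 si<s2 s2<j q
        ... | inj₂ refl = hne i (sym eg)

        es-inj : ∀ {k1 k2} → es k1 ≡ es k2 → k1 ≡ k2
        es-inj {k1} {k2} e with <-cmp (toℕ k1) (toℕ k2)
        ... | tri< lt _ _ = ⊥-elim (esne _ _ (m≤m+n i _) (+-monoʳ-< i lt) (idx< k2) e)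
        ... | tri≈ _ eq _ = toℕ-injective eq
        ... | tri> _ _ gt = ⊥-elim (esne _ _ (m≤m+n i _) (+-monoʳ-< i gt) (idx< k1) (sym e))

        consec : ∀ k k' → toℕ k' ≡ suc (toℕ k) % L → Joins G (es k) (vs k) (vs k')
        consec k k' e = subst (λ z → Joins G (es k) (vs k) z) (sym nxt) (joinsF (i + toℕ k))
          where
          nxt : vs k' ≡ Z (suc (i + toℕ k))
          nxt with m≤n⇒m<n∨m≡n (toℕ<n k)
          ... | inj₁ lt = cong Z (trans (cong (i +_) (trans e (m<n⇒m%n≡m {n = L} lt))) (+-suc i (toℕ k)))
          ... | inj₂ eq = trans (cong Z (trans (cong (i +_) (trans e (trans (cong (_% L) eq) (n%n≡0 L)))) (+-identityʳ i)))
                            (trans Zij (cong Z (trans (sym jeq) (trans (cong (i +_) (sym eq)) (+-suc i (toℕ k))))))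

        cyc : CycleIn G A
        cyc = record { j = jj ; vs = vs ; es = es ; vs-inj = vs-inj ; es-inj = es-inj
                     ; inA = λ k → AZ (i + toℕ k) ; consecutive = consec }

    result : CycleIn G A
    result with minimize Rep (proj₁ someRep) (proj₂ someRep)
    ... | j , repj , _ , minRep with exB-elim {j} {λ i → Z i ≡ᵇ Z j} repj
    ... | i , i<j , eij with m≤n⇒∃[o]m+o≡n i<j
    ... | zero , eq = ⊥-elim (joins-ne (joinsF i) (trans (≡ᵇ-true eij) (cong Z (trans (sym eq) (cong suc (+-identityʳ i))))))
    ... | suc jj , eq = FirstRepeat.Segment.cyc j repj minRep i i<j (≡ᵇ-true eij) jj (trans (+-suc i (suc jj)) eq)

  innerP : (Fin n → Bool) → Fin n → Fin m → Bool
  innerP A z g = inside A g ∧ incident G g z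

  innerDeg : (Fin n → Bool) → Fin n → ℕ
  innerDeg A z = count (innerP A z)

  cycle-mono : ∀ {A B} → (∀ z → A z ≡ true → B z ≡ true) → CycleIn G A → CycleIn G B
  cycle-mono h c = record { j = j ; vs = vs ; es = es ; vs-inj = vs-inj ; es-inj = es-inj
                          ; inA = λ i → h _ (inA i) ; consecutive = consecutive }
    where open CycleIn c

  -- When every vertex of A has inner degree ≥ 2, leave each vertex by the first
  -- inner edge other than the one used to arrive: a non-backtracking walk.
  module Walk (A : Fin n → Bool) (deg2 : ∀ z → A z ≡ true → 2 ≤ innerDeg A z)
    (z0 : Fin n) (h0 : Fin m) (Az0 : A z0 ≡ true) (ih0 : innerP A z0 h0 ≡ true) where

    cand : Fin n → Fin m → Fin m → Bool
    cand z h = rm (innerP A z) h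

    nextE : Fin n → Fin m → Fin m
    nextE z h = fromMaybe h (firstM (cand z h))

    nextE-spec : ∀ z h → A z ≡ true → innerP A z h ≡ true → cand z h (nextE z h) ≡ true
    nextE-spec z h az ih with count-pos (cand z h) (≤-pred (subst (2 ≤_) (sym (rm-count (innerP A z) h ih)) (deg2 z az)))
    ... | g , cg with firstM-some (cand z h) g cg
    ... | w , e rewrite e = firstM-sound (cand z h) e

    oth : Fin m → Fin n → Fin n
    oth g z = if e1 g ≡ᵇ z then e2 g else e1 g

    oth-spec : ∀ g z → incident G g z ≡ true → Joins G g z (oth g z)
    oth-spec g z inc with bool-cases (e1 g ≡ᵇ z)
    ... | inj₁ q rewrite q = inj₁ (cong (λ w → (w , e2 g)) (≡ᵇ-true q))
    ... | inj₂ q rewrite q = inj₂ (cong (λ w → (e1 g , w)) (≡ᵇ-true inc))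

    oth-inc : ∀ g z → incident G g (oth g z) ≡ true
    oth-inc g z with e1 g ≡ᵇ z
    ... | true = inc2 g
    ... | false = inc1 g

    oth-A : ∀ g z → inside A g ≡ true → A (oth g z) ≡ true
    oth-A g z h with e1 g ≡ᵇ z
    ... | true = ∧-true₂ {A (e1 g)} h
    ... | false = ∧-true₁ h

    step : Fin n × Fin m → Fin n × Fin m
    step p = oth (nextE (proj₁ p) (proj₂ p)) (proj₁ p) , nextE (proj₁ p) (proj₂ p)

    st : ℕ → Fin n × Fin m
    st zero = z0 , h0
    st (suc t) = step (st t)

    Z : ℕ → Fin n
    Z t = proj₁ (st t)
    H : ℕ → Fin m
    H t = proj₂ (st t)

    inv : ∀ t → A (Z t) ≡ true × innerP A (Z t) (H t) ≡ true
    inv zero = Az0 , ih0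
    inv (suc t) = oth-A g z (∧-true₁ ip) , ∧-intro (∧-true₁ ip) (oth-inc g z)
      where
      z = Z t
      g = nextE (Z t) (H t)
      c = nextE-spec (Z t) (H t) (proj₁ (inv t)) (proj₂ (inv t))
      ip : innerP A z g ≡ true
      ip = rm-sub (innerP A z) (H t) g c

    joinsF : ∀ t → Joins G (H (suc t)) (Z t) (Z (suc t))
    joinsF t = oth-spec _ _ (∧-true₂ {inside A (H (suc t))} (rm-sub (innerP A (Z t)) (H t) _ (nextE-spec (Z t) (H t) (proj₁ (inv t)) (proj₂ (inv t)))))

    hne : ∀ t → H (suc (suc t)) ≢ H (suc t)
    hne t = rm-ne (innerP A (Z (suc t))) (H (suc t)) _ (nextE-spec (Z (suc t)) (H (suc t)) (proj₁ (inv (suc t))) (proj₂ (inv (suc t))))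

    result : CycleIn G A
    result = Extract.result A Z H joinsF hne (λ t → proj₁ (inv t))

  lt2 : ℕ → Bool
  lt2 zero = true
  lt2 (suc zero) = true
  lt2 (suc (suc _)) = false

  lt2-true : ∀ k → lt2 k ≡ true → k ≤ 1
  lt2-true zero _ = z≤n
  lt2-true (suc zero) _ = s≤s z≤n

  lt2-false : ∀ k → lt2 k ≡ false → 2 ≤ k
  lt2-false (suc (suc k)) _ = s≤s (s≤s z≤n)

  eIn-split : ∀ A z → eIn A ≡ eIn (rm A z) + innerDeg A z
  eIn-split A z = trans (Σ'-cong per) (Σ'-+ (λ g → ind (inside (rm A z) g)) (λ g → ind (innerP A z g)))
    where
    per : ∀ g → ind (inside A g) ≡ ind (inside (rm A z) g) + ind (innerP A z g)
    per g with A (e1 g) | A (e2 g) | e1 g ≡ᵇ z | e2 g ≡ᵇ z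
    ... | true | true | true | true = refl
    ... | true | true | true | false = refl
    ... | true | true | false | true = refl
    ... | true | true | false | false = refl
    ... | true | false | true | true = refl
    ... | true | false | true | false = refl
    ... | true | false | false | true = refl
    ... | true | false | false | false = refl
    ... | false | true | true | true = refl
    ... | false | true | true | false = refl
    ... | false | true | false | true = refl
    ... | false | true | false | false = refl
    ... | false | false | true | true = refl
    ... | false | false | true | false = refl
    ... | false | false | false | true = refl
    ... | false | false | false | false = refl

  cycleIn : ∀ k A → count A ≤ k → 1 ≤ count A → count A ≤ eIn A → CycleIn G A
  cycleIn zero A le one ee = ⊥-elim (absurd (≤-trans one le))
    where absurd : 1 ≤ 0 → ⊥
          absurd ()
  cycleIn (suc k) A le one ee with bool-cases (anyF (λ z → A z ∧ lt2 (innerDeg A z)))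
  ... | inj₁ h with anyF-elim (λ z → A z ∧ lt2 (innerDeg A z)) h
  ... | z , hz = cycle-mono (λ x → rm-sub A z x) (cycleIn k A' le' one' ee')
    where
    A' = rm A z
    az = ∧-true₁ hz
    dz : innerDeg A z ≤ 1
    dz = lt2-true _ (∧-true₂ {A z} hz)
    cA : suc (count A') ≡ count A
    cA = rm-count A z az
    le' : count A' ≤ k
    le' = ≤-pred (subst (_≤ suc k) (sym cA) le)
    ee' : count A' ≤ eIn A'
    ee' = ≤-pred (begin
        suc (count A') ≡⟨ cA ⟩
        count A ≤⟨ ee ⟩
        eIn A ≡⟨ eIn-split A z ⟩
        eIn A' + innerDeg A z ≤⟨ +-monoʳ-≤ (eIn A') dz ⟩
        eIn A' + 1 ≡⟨ +-comm (eIn A') 1 ⟩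
        suc (eIn A') ∎)
      where open ≤-Reasoning
    one' : 1 ≤ count A'
    one' with bool-cases (anyF A')
    ... | inj₁ h' = count-≥1 A' _ (proj₂ (anyF-elim A' h'))
    ... | inj₂ h' = ⊥-elim (e1≢e2 g (trans (atz (e1 g) (∧-true₁ ig)) (sym (atz (e2 g) (∧-true₂ {A (e1 g)} ig)))))
      where
      none : ∀ x → A' x ≡ false
      none = anyF-false A' h'
      G1 = count-pos (inside A) (≤-trans one ee)
      g = proj₁ G1
      ig = proj₂ G1
      atz : ∀ x → A x ≡ true → x ≡ z
      atz x ax with fin-cases x z
      ... | inj₁ e = e
      ... | inj₂ ne = ⊥-elim (t≢f (rm-keep A z x ax ne) (none x))
  cycleIn (suc k) A le one ee | inj₂ h = Walk.result A deg2 z0 h0 az0 ih0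
    where
    deg2 : ∀ z → A z ≡ true → 2 ≤ innerDeg A z
    deg2 z az with bool-cases (lt2 (innerDeg A z))
    ... | inj₂ x = lt2-false _ x
    ... | inj₁ x = ⊥-elim (t≢f (∧-intro az x) (anyF-false _ h z))
    Z0 = count-pos A one
    z0 = proj₁ Z0
    az0 = proj₂ Z0
    H0 = count-pos (innerP A z0) (≤-trans (s≤s z≤n) (deg2 z0 az0))
    h0 = proj₁ H0
    ih0 = proj₂ H0

-- Edge cuts in a cyclically 4-edge-connected cubic graph.  A side K of a cut
-- with |∂K| ≤ |K| has e(K) ≥ |K| by 3|K| = 2 e(K) + |∂K|, hence contains a
-- cycle; so a cut with at most 3 edges cannot have |∂K| ≤ |K| and
-- |∂K| ≤ |V − K| with both sides nonempty.  Together with |∂K| ≡ |K| (mod 2)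
-- this gives |∂K| ≥ weight |K| for every K that misses at least two vertices,
-- where weight k = 3 if k is odd, plus 2 if k ≥ 2.
module CyclicCuts (G : Multigraph) (cubic : Cubic G) (c4 : Cyclically4EdgeConnected G) where

  open import Data.Nat using (ℕ; zero; suc; _+_; _*_; _≤_; z≤n; s≤s)
  open import Data.Nat.Properties
  open import Data.Fin using (Fin)
  open import Data.Bool using (Bool; true; false; not; _xor_)
  open import Data.Sum using (inj₁; inj₂)
  open import Data.Empty using (⊥; ⊥-elim)
  open import Function using (_∘_)
  open import Relation.Binary.PropositionalEquality
  open Booleans
  open FinSums
  open Handshake G
  open Cubic-facts cubic
  open Cycles G using (cycleIn)

  open Multigraph G

  cycleInSide : ∀ (K : Fin n → Bool) → cut K ≤ count K → 1 ≤ count K → CycleIn G K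
  cycleInSide K small nonempty = cycleIn n K (count-≤ K) nonempty (*-cancelˡ-≤ 2 twice)
    where
    open ≤-Reasoning
    twice : 2 * count K ≤ 2 * eIn K
    twice = +-cancelʳ-≤ (count K) (2 * count K) (2 * eIn K) (begin
      2 * count K + count K ≡⟨ trans (+-comm (2 * count K) (count K)) (*-comm 3 (count K)) ⟩
      count K * 3           ≡⟨ handshake-cut K ⟩
      2 * eIn K + cut K     ≤⟨ +-monoʳ-≤ (2 * eIn K) small ⟩
      2 * eIn K + count K   ∎)

  noSmallCut : ∀ (K : Fin n → Bool) → cut K ≤ 3 → cut K ≤ count K → 1 ≤ count K →
    cut K ≤ count (not ∘ K) → 1 ≤ count (not ∘ K) → ⊥
  noSmallCut K ≤3 ≤K K≠∅ ≤K' K'≠∅ = <-irrefl refl (≤-trans four ≤3)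
    where
    four : 4 ≤ cut K
    four = subst (4 ≤_) (len-filter (λ g → K (e1 g) xor K (e2 g)))
             (c4 K (cycleInSide K ≤K K≠∅) (cycleInSide (not ∘ K) (subst (_≤ count (not ∘ K)) (sym (cut-not K)) ≤K') K'≠∅))

  cut-parity : ∀ (K : Fin n → Bool) → oddB (cut K) ≡ oddB (count K)
  cut-parity K = sym (begin
      oddB (count K)                 ≡⟨ sym (oddB-*3 (count K)) ⟩
      oddB (count K * 3)             ≡⟨ cong oddB (handshake-cut K) ⟩
      oddB (2 * eIn K + cut K)       ≡⟨ oddB-+ (2 * eIn K) (cut K) ⟩
      oddB (2 * eIn K) xor oddB (cut K) ≡⟨ cong (_xor oddB (cut K)) (oddB-2* (eIn K)) ⟩
      oddB (cut K)                   ∎)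
    where open ≡-Reasoning

  complement-parity : ∀ (K : Fin n → Bool) → oddB (count (not ∘ K)) ≡ oddB (count K)
  complement-parity K = xor-false (oddB (count K)) (oddB (count (not ∘ K)))
    (trans (sym (oddB-+ (count K) (count (not ∘ K)))) (trans (cong oddB (count-not K)) n-even))
    where xor-false : ∀ a b → (a xor b) ≡ false → b ≡ a
          xor-false true true _ = refl
          xor-false false false _ = refl

  ge2 : ℕ → Bool
  ge2 zero = false
  ge2 (suc zero) = false
  ge2 (suc (suc _)) = true

  -- the least possible cut size of a side of size k
  weight : ℕ → ℕ
  weight k = 3 * ind (oddB k) + 2 * ind (ge2 k)

  weight-bound : ∀ c c' d → 2 ≤ c' → oddB d ≡ oddB c → oddB c' ≡ oddB c →
    (d ≤ 3 → d ≤ c → 1 ≤ c → d ≤ c' → 1 ≤ c' → ⊥) → weight c ≤ d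
  weight-bound zero c' d _ _ _ small = z≤n
  weight-bound (suc zero) c' zero _ () _ small
  weight-bound (suc zero) c' (suc zero) c'≥2 _ _ small = ⊥-elim (small (s≤s z≤n) ≤-refl ≤-refl (≤-trans (s≤s z≤n) c'≥2) (≤-trans (s≤s z≤n) c'≥2))
  weight-bound (suc zero) c' (suc (suc zero)) _ () _ small
  weight-bound (suc zero) c' (suc (suc (suc d))) _ _ _ small = s≤s (s≤s (s≤s z≤n))
  weight-bound (suc (suc c)) c' d c'≥2 pd pc' small with bool-cases (oddB c)
  ... | inj₁ oc = oddCase d pd small
    where
    odd : oddB (suc (suc c)) ≡ true
    odd = trans (oddB-+2 c) oc
    c≥1 : ∀ c → oddB c ≡ true → 1 ≤ c
    c≥1 (suc c) _ = s≤s z≤n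
    c'≥3 : 3 ≤ c'
    c'≥3 = odd≥2⇒≥3 c' c'≥2 (trans pc' odd)
      where odd≥2⇒≥3 : ∀ k → 2 ≤ k → oddB k ≡ true → 3 ≤ k
            odd≥2⇒≥3 (suc zero) (s≤s ()) _
            odd≥2⇒≥3 (suc (suc zero)) _ ()
            odd≥2⇒≥3 (suc (suc (suc k))) _ _ = s≤s (s≤s (s≤s z≤n))
    weight5 : weight (suc (suc c)) ≡ 5
    weight5 rewrite odd = refl
    oddCase : ∀ d → oddB d ≡ oddB (suc (suc c)) → (d ≤ 3 → d ≤ suc (suc c) → 1 ≤ suc (suc c) → d ≤ c' → 1 ≤ c' → ⊥) →
      weight (suc (suc c)) ≤ d
    oddCase zero pd small = ⊥-elim (t≢f odd (sym pd))
    oddCase (suc zero) pd small = ⊥-elim (small (s≤s z≤n) (s≤s z≤n) (s≤s z≤n) (≤-trans (s≤s z≤n) c'≥2) (≤-trans (s≤s z≤n) c'≥2))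
    oddCase (suc (suc zero)) pd small = ⊥-elim (t≢f odd (sym pd))
    oddCase (suc (suc (suc zero))) pd small = ⊥-elim (small ≤-refl (s≤s (s≤s (c≥1 c oc))) (s≤s z≤n) c'≥3 (≤-trans (s≤s z≤n) c'≥3))
    oddCase (suc (suc (suc (suc zero)))) pd small = ⊥-elim (t≢f odd (sym pd))
    oddCase (suc (suc (suc (suc (suc d))))) pd small rewrite weight5 = s≤s (s≤s (s≤s (s≤s (s≤s z≤n))))
  ... | inj₂ ec = evenCase d pd small
    where
    even : oddB (suc (suc c)) ≡ false
    even = trans (oddB-+2 c) ec
    weight2 : weight (suc (suc c)) ≡ 2
    weight2 rewrite even = refl
    evenCase : ∀ d → oddB d ≡ oddB (suc (suc c)) → (d ≤ 3 → d ≤ suc (suc c) → 1 ≤ suc (suc c) → d ≤ c' → 1 ≤ c' → ⊥) →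
      weight (suc (suc c)) ≤ d
    evenCase zero pd small = ⊥-elim (small z≤n z≤n (s≤s z≤n) z≤n (≤-trans (s≤s z≤n) c'≥2))
    evenCase (suc zero) pd small = ⊥-elim (t≢f (sym pd) even)
    evenCase (suc (suc d)) pd small rewrite weight2 = s≤s (s≤s z≤n)

  cut≥weight : ∀ (K : Fin n → Bool) (x y : Fin n) → x ≢ y → K x ≡ false → K y ≡ false → weight (count K) ≤ cut K
  cut≥weight K x y x≢y kx ky =
    weight-bound (count K) (count (not ∘ K)) (cut K) outside≥2 (cut-parity K) (complement-parity K) (noSmallCut K)
    where
    outside≥2 : 2 ≤ count (not ∘ K)
    outside≥2 = count-≥2 (not ∘ K) x y x≢y (not-false kx) (not-false ky)

-- The easy direction.  Suppose G − e − f is properly 2-coloured with both ends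
-- of e coloured b and both ends of f coloured not b, and let X be the vertices
-- coloured b, Y the others.  Counting edge ends, 3|X| = (ends in X) and each
-- edge other than e, f has one end on each side, so 3|X| − 2 = 3|Y| − 2, i.e.
-- |X| = |Y|.  A perfect matching M with f ∈ M, e ∉ M covers X by the X-ends of
-- its edges and Y likewise, so |Y| = |X| + 2.  Contradiction.
module ColourCount (G : Multigraph) (cubic : Cubic G) where

  open import Data.Nat using (zero; suc; _+_; _*_)
  open import Data.Nat.Properties using (+-cancelʳ-≡; *-cancelʳ-≡; suc-injective)
  open import Data.Fin using (Fin)
  open import Data.Bool using (Bool; true; false; not; _∧_; _xor_)
  open import Data.Product using (Σ; _×_; _,_)
  open import Data.Sum using (_⊎_; inj₁; inj₂)
  open import Data.Empty using (⊥; ⊥-elim)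
  open import Relation.Nullary using (¬_)
  open import Relation.Binary.PropositionalEquality
  open Booleans
  open FinSums
  open Handshake G
  open Cubic-facts cubic

  open Multigraph G

  sameColour : Bool → Bool → Bool
  sameColour x y = not (x xor y)

  module _ (e f : Fin m) (e≢f : e ≢ f) (c : Fin n → Bool) (b : Bool)
           (proper : ∀ g → g ≢ e → g ≢ f → c (end₁ G g) ≢ c (end₂ G g))
           (ce1 : c (e1 e) ≡ b) (ce2 : c (e2 e) ≡ b) (cf1 : c (e1 f) ≡ not b) (cf2 : c (e2 f) ≡ not b) where

    X Y : Fin n → Bool
    X v = sameColour (c v) b
    Y v = not (X v)

    edgeKind : ∀ g → g ≡ e ⊎ (g ≡ f ⊎ (g ≢ e × g ≢ f))
    edgeKind g with fin-cases g e | fin-cases g f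
    ... | inj₁ x | _ = inj₁ x
    ... | inj₂ _ | inj₁ y = inj₂ (inj₁ y)
    ... | inj₂ x | inj₂ y = inj₂ (inj₂ (x , y))

    same-b : ∀ b → sameColour b b ≡ true
    same-b true = refl
    same-b false = refl

    same-not-b : ∀ b → sameColour (not b) b ≡ false
    same-not-b true = refl
    same-not-b false = refl

    endsBalance : ∀ g → endsIn X g + 2 * ind (g ≡ᵇ f) ≡ endsIn Y g + 2 * ind (g ≡ᵇ e)
    endsBalance g with edgeKind g
    ... | inj₁ refl rewrite ≡ᵇ-refl g | ≡ᵇ-false e≢f | ce1 | ce2 | same-b b = refl
    ... | inj₂ (inj₁ refl) rewrite ≡ᵇ-refl g | ≡ᵇ-false (λ f≡e → e≢f (sym f≡e)) | cf1 | cf2 | same-not-b b = refl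
    ... | inj₂ (inj₂ (g≢e , g≢f)) rewrite ≡ᵇ-false g≢e | ≡ᵇ-false g≢f = split (c (e1 g)) (c (e2 g)) b (proper g g≢e g≢f)
      where split : ∀ c₁ c₂ b → c₁ ≢ c₂ →
                    ind (sameColour c₁ b) + ind (sameColour c₂ b) + 0 ≡ ind (not (sameColour c₁ b)) + ind (not (sameColour c₂ b)) + 0
            split true true b ne = ⊥-elim (ne refl)
            split false false b ne = ⊥-elim (ne refl)
            split true false true ne = refl
            split true false false ne = refl
            split false true true ne = refl
            split false true false ne = refl

    |X|≡|Y| : count X ≡ count Y
    |X|≡|Y| = *-cancelʳ-≡ (count X) (count Y) 3 (+-cancelʳ-≡ _ _ _ (begin
        count X * 3 + 2                              ≡⟨ cong (_+ 2) (handshake X) ⟩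
        Σ' (endsIn X) + 2                            ≡⟨ sym (Σ'-plus2 (endsIn X) f) ⟩
        Σ' (λ g → endsIn X g + 2 * ind (g ≡ᵇ f))     ≡⟨ Σ'-cong endsBalance ⟩
        Σ' (λ g → endsIn Y g + 2 * ind (g ≡ᵇ e))     ≡⟨ Σ'-plus2 (endsIn Y) e ⟩
        Σ' (endsIn Y) + 2                            ≡⟨ cong (_+ 2) (sym (handshake Y)) ⟩
        count Y * 3 + 2                              ∎))
      where open ≡-Reasoning

    module _ (M : Fin m → Bool) (pm : PerfectMatching G M) (Me : M e ≡ false) (Mf : M f ≡ true) where

      matchedBalance : ∀ g → (ind (M g ∧ X (e1 g)) + ind (M g ∧ X (e2 g))) + 2 * ind (g ≡ᵇ f) ≡
                             ind (M g ∧ Y (e1 g)) + ind (M g ∧ Y (e2 g))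
      matchedBalance g with edgeKind g
      ... | inj₁ refl rewrite ≡ᵇ-false e≢f | Me = refl
      ... | inj₂ (inj₁ refl) rewrite ≡ᵇ-refl g | Mf | cf1 | cf2 | same-not-b b = refl
      ... | inj₂ (inj₂ (g≢e , g≢f)) rewrite ≡ᵇ-false g≢f = split (M g) (c (e1 g)) (c (e2 g)) b (proper g g≢e g≢f)
        where split : ∀ mg c₁ c₂ b → c₁ ≢ c₂ →
                      ind (mg ∧ sameColour c₁ b) + ind (mg ∧ sameColour c₂ b) + 0 ≡
                      ind (mg ∧ not (sameColour c₁ b)) + ind (mg ∧ not (sameColour c₂ b))
              split mg true true b ne = ⊥-elim (ne refl)
              split mg false false b ne = ⊥-elim (ne refl)
              split false true false b ne = refl
              split false false true b ne = refl
              split true true false true ne = refl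
              split true true false false ne = refl
              split true false true true ne = refl
              split true false true false ne = refl

      |X|+2≡|Y| : count X + 2 ≡ count Y
      |X|+2≡|Y| = begin
          count X + 2 ≡⟨ cong (_+ 2) (matchedEnds M pm X) ⟩
          Σ' (λ g → ind (M g ∧ X (e1 g)) + ind (M g ∧ X (e2 g))) + 2 ≡⟨ sym (Σ'-plus2 _ f) ⟩
          Σ' (λ g → (ind (M g ∧ X (e1 g)) + ind (M g ∧ X (e2 g))) + 2 * ind (g ≡ᵇ f)) ≡⟨ Σ'-cong matchedBalance ⟩
          Σ' (λ g → ind (M g ∧ Y (e1 g)) + ind (M g ∧ Y (e2 g))) ≡⟨ sym (matchedEnds M pm Y) ⟩
          count Y ∎
        where open ≡-Reasoning

      contradiction : ⊥
      contradiction = k+2≢k (count X) (trans |X|+2≡|Y| (sym |X|≡|Y|))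
        where k+2≢k : ∀ k → k + 2 ≢ k
              k+2≢k zero ()
              k+2≢k (suc k) eq = k+2≢k k (suc-injective eq)

  separated⇒noMatching : ∀ e f → e ≢ f → BipartiteSeparating G e f →
    ¬ (Σ (Fin m → Bool) λ M → PerfectMatching G M × M e ≡ false × M f ≡ true)
  separated⇒noMatching e f e≢f (c , b , proper , ce1 , ce2 , cf1 , cf2) (M , pm , Me , Mf) =
    contradiction e f e≢f c b proper ce1 ce2 cf1 cf2 M pm Me Mf

-- The reduction to Tutte's theorem.  Let u, v be the ends of f and H the graph
-- G − e on W = V(G) − u − v, with Boolean adjacency adjH.  A perfect matching of
-- H (a pairing of vertices) lifts to a set of edges of G − e by choosing, for
-- each matched pair, the first edge other than e joining it; adding f gives a
-- perfect matching of G containing f and avoiding e.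
module ForcedEdge (G : Multigraph) (e f : Fin (Multigraph.m G)) (e≢f : e ≢ f) where

  open import Data.Bool using (Bool; true; false; not; _∧_; _∨_)
  open import Data.Bool.Properties using (∨-comm)
  open import Data.Product using (Σ; _×_; _,_; proj₁; proj₂)
  open import Data.Sum using (_⊎_; inj₁; inj₂)
  open import Data.Empty using (⊥-elim)
  open import Data.Maybe using (Maybe; just; nothing)
  open import Relation.Binary.PropositionalEquality
  open Booleans
  open FinSums
  open Matchings
  open Handshake G using (e1; e2; e1≢e2; inc1; inc2; inc-ends)

  open Multigraph G

  u v : Fin n
  u = e1 f
  v = e2 f

  W : Fin n → Bool
  W = rm (rm (λ _ → true) u) v

  W-u : W u ≡ false
  W-u with fin-cases u v
  ... | inj₁ e = ⊥-elim (e1≢e2 f e)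
  ... | inj₂ ne rewrite ≡ᵇ-refl u = refl

  W-v : W v ≡ false
  W-v = rm-x (rm (λ _ → true) u) v

  W-ne : ∀ {z} → W z ≡ true → z ≢ u × z ≢ v
  W-ne {z} h = rm-ne (λ _ → true) u z (rm-sub (rm (λ _ → true) u) v z h) , rm-ne (rm (λ _ → true) u) v z h

  joinsB : Fin m → Fin n → Fin n → Bool
  joinsB g x y = ((e1 g ≡ᵇ x) ∧ (e2 g ≡ᵇ y)) ∨ ((e1 g ≡ᵇ y) ∧ (e2 g ≡ᵇ x))

  joinsB-sym : ∀ g x y → joinsB g x y ≡ joinsB g y x
  joinsB-sym g x y = ∨-comm ((e1 g ≡ᵇ x) ∧ (e2 g ≡ᵇ y)) ((e1 g ≡ᵇ y) ∧ (e2 g ≡ᵇ x))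

  joinsB-ends : ∀ g → joinsB g (e1 g) (e2 g) ≡ true
  joinsB-ends g rewrite ≡ᵇ-refl (e1 g) | ≡ᵇ-refl (e2 g) = refl

  joinsB-true : ∀ {g x y} → joinsB g x y ≡ true → (e1 g ≡ x × e2 g ≡ y) ⊎ (e1 g ≡ y × e2 g ≡ x)
  joinsB-true {g} {x} {y} h with e1 g ≡ᵇ x in q1 | e2 g ≡ᵇ y in q2 | e1 g ≡ᵇ y in q3 | e2 g ≡ᵇ x in q4
  ... | true | true | _ | _ = inj₁ (≡ᵇ-true q1 , ≡ᵇ-true q2)
  ... | true | false | true | true = inj₂ (≡ᵇ-true q3 , ≡ᵇ-true q4)
  ... | false | _ | true | true = inj₂ (≡ᵇ-true q3 , ≡ᵇ-true q4)

  adjH : Fin n → Fin n → Bool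
  adjH x y = anyF (λ g → not (g ≡ᵇ e) ∧ joinsB g x y)

  adjH-sym : Sym adjH
  adjH-sym x y = anyF-cong (λ g → cong (not (g ≡ᵇ e) ∧_) (joinsB-sym g x y))

  Qg : Fin n → Fin n → Fin m → Bool
  Qg a b g = not (g ≡ᵇ e) ∧ joinsB g a b

  Qg-cong : ∀ {a b a' b'} → (a ≡ a' × b ≡ b') ⊎ (a ≡ b' × b ≡ a') → ∀ g → Qg a b g ≡ Qg a' b' g
  Qg-cong (inj₁ (refl , refl)) g = refl
  Qg-cong {a} {b} (inj₂ (refl , refl)) g = cong (not (g ≡ᵇ e) ∧_) (joinsB-sym g a b)

  isJ : Maybe (Fin m) → Fin m → Bool
  isJ (just x) g = x ≡ᵇ g
  isJ nothing g = false

  isJ-true : ∀ {mb g} → isJ mb g ≡ true → mb ≡ just g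
  isJ-true {just x} h = cong just (≡ᵇ-true h)

  module Lift (pm : PM W adjH) where
    open PM pm

    canon : Fin m → Bool
    canon g = isJ (firstM (Qg (e1 g) (e2 g))) g

    M : Fin m → Bool
    M g = (g ≡ᵇ f) ∨ (not (g ≡ᵇ e) ∧ (W (e1 g) ∧ ((p (e1 g) ≡ᵇ e2 g) ∧ canon g)))

    M-dec : ∀ {g} → M g ≡ true → g ≢ f → g ≢ e × W (e1 g) ≡ true × p (e1 g) ≡ e2 g × firstM (Qg (e1 g) (e2 g)) ≡ just g
    M-dec {g} h gf rewrite ≡ᵇ-false gf with g ≡ᵇ e in q1 | W (e1 g) in q2 | p (e1 g) ≡ᵇ e2 g in q3 | canon g in q4
    ... | false | true | true | true = ≡ᵇ-false⁻¹ q1 , refl , ≡ᵇ-true q3 , isJ-true q4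

    Me : M e ≡ false
    Me rewrite ≡ᵇ-false e≢f | ≡ᵇ-refl e = refl

    Mf : M f ≡ true
    Mf rewrite ≡ᵇ-refl f = refl

    M-W : ∀ {g} → M g ≡ true → g ≢ f → W (e1 g) ≡ true × W (e2 g) ≡ true
    M-W h gf with M-dec h gf
    ... | _ , w1 , pe , _ = w1 , subst (λ z → W z ≡ true) pe (pW _ w1)

    coveredOffW : ∀ w → W w ≡ false → count (λ g → M g ∧ incident G g w) ≡ 1
    coveredOffW w ww = count-unique _ f (∧-intro Mf incf) uniq
      where
      incf : incident G f w ≡ true
      incf with fin-cases w u | fin-cases w v
      ... | inj₁ refl | _ = inc1 f
      ... | inj₂ _ | inj₁ refl = inc2 f
      ... | inj₂ nu | inj₂ nv = ⊥-elim (t≢f (rm-keep (rm (λ _ → true) u) v w (rm-keep (λ _ → true) u w refl nu) nv) ww)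
      uniq : ∀ g → (M g ∧ incident G g w) ≡ true → g ≡ f
      uniq g h with fin-cases g f
      ... | inj₁ x = x
      ... | inj₂ gf with M-W (∧-true₁ h) gf | inc-ends {g} {w} (∧-true₂ {M g} h)
      ... | w1 , w2 | inj₁ refl = ⊥-elim (t≢f w1 ww)
      ... | w1 , w2 | inj₂ refl = ⊥-elim (t≢f w2 ww)

    coveredInW : ∀ w → W w ≡ true → count (λ g → M g ∧ incident G g w) ≡ 1
    coveredInW w ww = count-unique _ g0 (∧-intro Mg0 incg0) uniq
      where
      w' = p w
      ww' : W w' ≡ true
      ww' = pW w ww
      A = anyF-elim (λ g → not (g ≡ᵇ e) ∧ joinsB g w w') (padj w ww)
      F = firstM-some (Qg w w') (proj₁ A) (proj₂ A)
      g0 = proj₁ F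
      fg0 : firstM (Qg w w') ≡ just g0
      fg0 = proj₂ F
      qg0 : Qg w w' g0 ≡ true
      qg0 = firstM-sound (Qg w w') fg0
      g0e : g0 ≢ e
      g0e = ≡ᵇ-false⁻¹ (not-true (∧-true₁ qg0))
      ends0 = joinsB-true (∧-true₂ {not (g0 ≡ᵇ e)} qg0)
      incg0 : incident G g0 w ≡ true
      incg0 with ends0
      ... | inj₁ (x , _) = subst (λ z → incident G g0 z ≡ true) x (inc1 g0)
      ... | inj₂ (_ , x) = subst (λ z → incident G g0 z ≡ true) x (inc2 g0)
      canon0 : canon g0 ≡ true
      canon0 rewrite firstM-cong (Qg-cong {e1 g0} {e2 g0} {w} {w'} ends0) | fg0 = ≡ᵇ-refl g0
      Mg0 : M g0 ≡ true
      Mg0 = ∨-introʳ {g0 ≡ᵇ f} (∧-intro (not-false (≡ᵇ-false g0e)) (∧-intro W1 (∧-intro (≡ᵇ-refl' P1) canon0)))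
        where
        ≡ᵇ-refl' : ∀ {x y : Fin n} → x ≡ y → (x ≡ᵇ y) ≡ true
        ≡ᵇ-refl' {x} refl = ≡ᵇ-refl x
        W1 : W (e1 g0) ≡ true
        W1 with ends0
        ... | inj₁ (x , _) rewrite x = ww
        ... | inj₂ (x , _) rewrite x = ww'
        P1 : p (e1 g0) ≡ e2 g0
        P1 with ends0
        ... | inj₁ (x , y) rewrite x | y = refl
        ... | inj₂ (x , y) rewrite x | y = pp w ww
      uniq : ∀ g → (M g ∧ incident G g w) ≡ true → g ≡ g0
      uniq g h with fin-cases g f
      ... | inj₁ refl with inc-ends {f} {w} (∧-true₂ {M f} h)
      ... | inj₁ x = ⊥-elim (proj₁ (W-ne ww) (sym x))
      ... | inj₂ x = ⊥-elim (proj₂ (W-ne ww) (sym x))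
      uniq g h | inj₂ gf with M-dec (∧-true₁ h) gf
      ... | ge , w1 , pe , fm = just-inj (trans (sym fm) (trans (firstM-cong (Qg-cong endsG)) fg0))
        where
        just-inj : ∀ {a b : Fin m} → just a ≡ just b → a ≡ b
        just-inj refl = refl
        endsG : (e1 g ≡ w × e2 g ≡ w') ⊎ (e1 g ≡ w' × e2 g ≡ w)
        endsG with inc-ends {g} {w} (∧-true₂ {M g} h)
        ... | inj₁ x = inj₁ (x , trans (sym pe) (cong p x))
        ... | inj₂ x = inj₂ (trans (sym (pp (e1 g) w1)) (cong p (trans pe x)) , x)

    pmG : PerfectMatching G M
    pmG w with bool-cases (W w)
    ... | inj₁ ww = trans (len-filter (λ g → M g ∧ incident G g w)) (coveredInW w ww)
    ... | inj₂ ww = trans (len-filter (λ g → M g ∧ incident G g w)) (coveredOffW w ww)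

    liftedMatching : Σ (Fin m → Bool) λ M → PerfectMatching G M × M e ≡ false × M f ≡ true
    liftedMatching = M , pmG , Me , Mf

-- The hard direction.  Let (S, lab) be a barrier of H = G − e − u − v, R the
-- vertices of H outside S, T = S ∪ {u, v} its complement in V(G) and q the
-- number of odd classes.  By parity q ≥ |S| + 2 = |T|.  Each class K ⊆ R misses
-- u and v, so |∂K| ≥ weight |K|; summing, 3q + 2B ≤ Σ_g (classes crossed by g),
-- with B the number of classes of size ≥ 2.  An edge crosses at most as many
-- classes as it has ends in R, and none if both ends lie in R (they share a
-- class); comparing with the 3|T| edge ends at T leaves no slack: B = 0, no edge
-- other than e, f joins two vertices of T, and e has no end in T.  Hence T and R
-- are the colour classes of G − e − f, with e inside R and f = uv inside T.
module BarrierAnalysis (G : Multigraph) (cubic : Cubic G) (c4 : Cyclically4EdgeConnected G)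
  (e f : Fin (Multigraph.m G)) (e≢f : e ≢ f) where

  open import Data.Nat using (ℕ; zero; suc; _+_; _*_; _≤_; _<_; z≤n; s≤s)
  open import Data.Nat.Properties
  open import Data.Bool using (Bool; true; false; not; _∧_; _xor_)
  open import Data.Bool.Properties using (∧-zeroʳ; ∧-identityʳ)
  open import Data.Product using (_×_; _,_; proj₁; proj₂)
  open import Data.Sum using (inj₁; inj₂)
  open import Data.Empty using (⊥; ⊥-elim)
  open import Relation.Binary.PropositionalEquality
  open import Algebra.Properties.CommutativeSemigroup +-commutativeSemigroup using (xy∙z≈xz∙y)
  open Booleans
  open FinSums
  open Tutte using (Barrier; blockSize; qOdd)
  open Handshake G
  open Cubic-facts cubic
  open ForcedEdge G e f e≢f using (u; v; W; W-u; W-v; joinsB; joinsB-ends; adjH)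
  open CyclicCuts G cubic c4 using (ge2; weight; cut≥weight)

  open Multigraph G

  u≢v : u ≢ v
  u≢v = e1≢e2 f

  module _ (β : Barrier W adjH) where
    open Barrier β

    R : Fin n → Bool
    R z = W z ∧ not (S z)

    T : Fin n → Bool
    T z = not (R z)

    inClass : Fin n → Fin n → Bool
    inClass ℓ z = W z ∧ (not (S z) ∧ (lab z ≡ᵇ ℓ))

    classSize : Fin n → ℕ
    classSize ℓ = blockSize W S lab ℓ

    q : ℕ
    q = qOdd W S lab

    R-dec : ∀ {x} → R x ≡ true → W x ≡ true × S x ≡ false
    R-dec {x} h = ∧-true₁ h , not-true (∧-true₂ {W x} h)

    R-u : R u ≡ false
    R-u rewrite W-u = refl

    R-v : R v ≡ false
    R-v rewrite W-v = refl

    inClass-R : ∀ z → R z ≡ true → ∀ ℓ → inClass ℓ z ≡ (lab z ≡ᵇ ℓ)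
    inClass-R z rz ℓ rewrite proj₁ (R-dec rz) | proj₂ (R-dec rz) = refl

    classes-at : ∀ z → Σ' (λ ℓ → ind (inClass ℓ z)) ≡ ind (R z)
    classes-at z = trans (Σ'-point _ (lab z) elsewhere) (cong ind own)
      where
      elsewhere : ∀ ℓ → ℓ ≢ lab z → ind (inClass ℓ z) ≡ 0
      elsewhere ℓ ℓ≢ rewrite ≡ᵇ-false {x = lab z} {y = ℓ} (λ e → ℓ≢ (sym e)) | ∧-zeroʳ (not (S z)) | ∧-zeroʳ (W z) = refl
      own : inClass (lab z) z ≡ R z
      own rewrite ≡ᵇ-refl (lab z) = cong (W z ∧_) (∧-identityʳ (not (S z)))

    partition : Σ' classSize ≡ count R
    partition = trans (Σ'-swap (λ ℓ z → ind (inClass ℓ z))) (Σ'-cong classes-at)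

    |W|+2≡n : count W + 2 ≡ n
    |W|+2≡n = trans (+-comm (count W) 2)
      (trans (cong suc (rm-count (rm (λ _ → true) u) v (rm-keep (λ _ → true) u v refl (λ v≡u → u≢v (sym v≡u)))))
             (trans (rm-count (λ _ → true) u refl) (count-true {n})))

    |W|≡|S|+|R| : count W ≡ count S + count R
    |W|≡|S|+|R| = trans (Σ'-cong (λ z → split (W z) (S z) (S⊆W z))) (Σ'-+ (λ z → ind (S z)) (λ z → ind (R z)))
      where split : ∀ w s → (s ≡ true → w ≡ true) → ind w ≡ ind s + ind (w ∧ not s)
            split w true h rewrite h refl = refl
            split true false h = refl
            split false false h = refl

    |T|≡|S|+2 : count T ≡ count S + 2
    |T|≡|S|+2 = +-cancelʳ-≡ (count R) _ _ (begin
        count T + count R      ≡⟨ +-comm (count T) (count R) ⟩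
        count R + count T      ≡⟨ count-not R ⟩
        n                      ≡⟨ sym |W|+2≡n ⟩
        count W + 2            ≡⟨ cong (_+ 2) |W|≡|S|+|R| ⟩
        count S + count R + 2  ≡⟨ xy∙z≈xz∙y (count S) (count R) 2 ⟩
        count S + 2 + count R  ∎)
      where open ≡-Reasoning

    -- |S| ≡ q (mod 2): |W| is even and the classes partition W − S
    |S|≡q-mod2 : oddB (count S) ≡ oddB q
    |S|≡q-mod2 = trans (xor-false (oddB (count S)) (oddB (count R)) sumEven)
                       (trans (cong oddB (sym partition)) (oddB-Σ' classSize))
      where
      W-even : oddB (count W) ≡ false
      W-even = trans (sym (oddB-+2 (count W))) (trans (cong oddB (trans (+-comm 2 (count W)) |W|+2≡n)) n-even)
      sumEven : (oddB (count S) xor oddB (count R)) ≡ false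
      sumEven = trans (sym (oddB-+ (count S) (count R))) (trans (cong oddB (sym |W|≡|S|+|R|)) W-even)
      xor-false : ∀ a b → (a xor b) ≡ false → a ≡ b
      xor-false true true _ = refl
      xor-false false false _ = refl

    |T|≤q : count T ≤ q
    |T|≤q = subst (_≤ q) (sym |T|≡|S|+2) (same-parity-< (count S) q many |S|≡q-mod2)
      where
      same-parity-< : ∀ a b → a < b → oddB a ≡ oddB b → a + 2 ≤ b
      same-parity-< a (suc b) (s≤s a≤b) p with m≤n⇒m<n∨m≡n a≤b
      ... | inj₁ a<b = subst (_≤ suc b) (+-comm 2 a) (s≤s a<b)
      ... | inj₂ refl = ⊥-elim (not-fixed (oddB a) p)
        where not-fixed : ∀ x → x ≡ not x → ⊥
              not-fixed true ()
              not-fixed false ()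

    B : ℕ
    B = count (λ ℓ → ge2 (classSize ℓ))

    crossings : Fin m → ℕ
    crossings g = Σ' (λ ℓ → ind (inClass ℓ (e1 g) xor inClass ℓ (e2 g)))

    classCuts : 3 * q + 2 * B ≤ Σ' crossings
    classCuts = begin
        3 * q + 2 * B
          ≡⟨ sym (cong₂ _+_ (Σ'-*ˡ 3 (λ ℓ → ind (oddB (classSize ℓ)))) (Σ'-*ˡ 2 (λ ℓ → ind (ge2 (classSize ℓ))))) ⟩
        Σ' (λ ℓ → 3 * ind (oddB (classSize ℓ))) + Σ' (λ ℓ → 2 * ind (ge2 (classSize ℓ)))
          ≡⟨ sym (Σ'-+ (λ ℓ → 3 * ind (oddB (classSize ℓ))) (λ ℓ → 2 * ind (ge2 (classSize ℓ)))) ⟩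
        Σ' (λ ℓ → weight (classSize ℓ))
          ≤⟨ Σ'-mono (λ ℓ → cut≥weight (inClass ℓ) u v u≢v (notInClass-u ℓ) (notInClass-v ℓ)) ⟩
        Σ' (λ ℓ → cut (inClass ℓ))
          ≡⟨ Σ'-swap (λ ℓ g → ind (inClass ℓ (e1 g) xor inClass ℓ (e2 g))) ⟩
        Σ' crossings ∎
      where
      open ≤-Reasoning
      notInClass-u : ∀ ℓ → inClass ℓ u ≡ false
      notInClass-u ℓ rewrite W-u = refl
      notInClass-v : ∀ ℓ → inClass ℓ v ≡ false
      notInClass-v ℓ rewrite W-v = refl

    crossings≤ends : ∀ g → crossings g ≤ ind (R (e1 g)) + ind (R (e2 g))
    crossings≤ends g = begin
        crossings g                                                       ≤⟨ Σ'-mono (λ ℓ → ind-xor (inClass ℓ (e1 g)) (inClass ℓ (e2 g))) ⟩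
        Σ' (λ ℓ → ind (inClass ℓ (e1 g)) + ind (inClass ℓ (e2 g)))        ≡⟨ Σ'-+ (λ ℓ → ind (inClass ℓ (e1 g))) (λ ℓ → ind (inClass ℓ (e2 g))) ⟩
        Σ' (λ ℓ → ind (inClass ℓ (e1 g))) + Σ' (λ ℓ → ind (inClass ℓ (e2 g))) ≡⟨ cong₂ _+_ (classes-at (e1 g)) (classes-at (e2 g)) ⟩
        ind (R (e1 g)) + ind (R (e2 g))                                   ∎
      where
      open ≤-Reasoning
      ind-xor : ∀ a b → ind (a xor b) ≤ ind a + ind b
      ind-xor true true = z≤n
      ind-xor true false = ≤-refl
      ind-xor false true = ≤-refl
      ind-xor false false = z≤n

    sameClass : ∀ g → g ≢ e → R (e1 g) ≡ true → R (e2 g) ≡ true → lab (e1 g) ≡ lab (e2 g)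
    sameClass g g≢e r1 r2 = closed (e1 g) (e2 g) (proj₁ (R-dec r1)) (proj₁ (R-dec r2)) (proj₂ (R-dec r1)) (proj₂ (R-dec r2))
      (anyF-intro (λ g' → not (g' ≡ᵇ e) ∧ joinsB g' (e1 g) (e2 g)) g (∧-intro (not-false (≡ᵇ-false g≢e)) (joinsB-ends g)))

    crossings-inside : ∀ g → g ≢ e → R (e1 g) ≡ true → R (e2 g) ≡ true → crossings g ≡ 0
    crossings-inside g g≢e r1 r2 = Σ'-0 λ ℓ → cong ind (begin
        inClass ℓ (e1 g) xor inClass ℓ (e2 g)                 ≡⟨ cong₂ _xor_ (inClass-R (e1 g) r1 ℓ) (inClass-R (e2 g) r2 ℓ) ⟩
        (lab (e1 g) ≡ᵇ ℓ) xor (lab (e2 g) ≡ᵇ ℓ)               ≡⟨ cong (λ l → (lab (e1 g) ≡ᵇ ℓ) xor (l ≡ᵇ ℓ)) (sym (sameClass g g≢e r1 r2)) ⟩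
        (lab (e1 g) ≡ᵇ ℓ) xor (lab (e1 g) ≡ᵇ ℓ)               ≡⟨ xor-self (lab (e1 g) ≡ᵇ ℓ) ⟩
        false                                                 ∎)
      where
      open ≡-Reasoning
      xor-self : ∀ b → (b xor b) ≡ false
      xor-self true = refl
      xor-self false = refl

    innerT : Fin m → Bool
    innerT g = not (g ≡ᵇ e) ∧ (not (g ≡ᵇ f) ∧ (T (e1 g) ∧ T (e2 g)))

    eEndsInT : Fin m → ℕ
    eEndsInT g = ind ((g ≡ᵇ e) ∧ T (e1 g)) + ind ((g ≡ᵇ e) ∧ T (e2 g))

    eEnds : ℕ
    eEnds = ind (T (e1 e)) + ind (T (e2 e))

    -- Per edge, what the classes and T demand is at most what the ends of g
    -- at T supply, the edge e supplying 2 extra (its ends count towards R).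
    demand supply : Fin m → ℕ
    demand g = crossings g + 2 * ind (innerT g) + 2 * eEndsInT g + 2 * ind (g ≡ᵇ f)
    supply g = endsIn T g + 2 * ind (g ≡ᵇ e)

    edgeBound-e : demand e ≤ supply e
    edgeBound-e rewrite ≡ᵇ-refl e | ≡ᵇ-false e≢f = atE (R (e1 e)) (R (e2 e)) (crossings e) (crossings≤ends e)
      where
      atE : ∀ r1 r2 x → x ≤ ind r1 + ind r2 →
        x + 2 * 0 + 2 * (ind (not r1) + ind (not r2)) + 2 * 0 ≤ ind (not r1) + ind (not r2) + 2 * 1
      atE true true zero h = z≤n
      atE true true (suc zero) h = s≤s z≤n
      atE true true (suc (suc zero)) h = ≤-refl
      atE true true (suc (suc (suc x))) (s≤s (s≤s ()))
      atE true false zero h = s≤s (s≤s z≤n)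
      atE true false (suc zero) h = ≤-refl
      atE true false (suc (suc x)) (s≤s ())
      atE false true zero h = s≤s (s≤s z≤n)
      atE false true (suc zero) h = ≤-refl
      atE false true (suc (suc x)) (s≤s ())
      atE false false x h rewrite n≤0⇒n≡0 h = ≤-refl

    crossings-f : crossings f ≡ 0
    crossings-f = n≤0⇒n≡0 (subst (crossings f ≤_) (cong₂ _+_ (cong ind R-u) (cong ind R-v)) (crossings≤ends f))

    edgeBound-f : demand f ≤ supply f
    edgeBound-f rewrite ≡ᵇ-refl f | ≡ᵇ-false (λ f≡e → e≢f (sym f≡e)) | R-u | R-v | crossings-f = ≤-refl

    edgeBound-other : ∀ g → g ≢ e → g ≢ f → demand g ≤ supply g
    edgeBound-other g g≢e g≢f rewrite ≡ᵇ-false g≢e | ≡ᵇ-false g≢f =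
      atOther (R (e1 g)) (R (e2 g)) (crossings g) (crossings≤ends g) (crossings-inside g g≢e)
      where
      atOther : ∀ r1 r2 x → x ≤ ind r1 + ind r2 → (r1 ≡ true → r2 ≡ true → x ≡ 0) →
        x + 2 * ind (not r1 ∧ not r2) + 2 * (ind false + ind false) + 2 * 0 ≤ ind (not r1) + ind (not r2) + 2 * 0
      atOther true true x _ none rewrite none refl refl = z≤n
      atOther true false zero _ _ = z≤n
      atOther true false (suc zero) _ _ = ≤-refl
      atOther true false (suc (suc x)) (s≤s ()) _
      atOther false true zero _ _ = z≤n
      atOther false true (suc zero) _ _ = ≤-refl
      atOther false true (suc (suc x)) (s≤s ()) _
      atOther false false x h _ rewrite n≤0⇒n≡0 h = ≤-refl

    edgeBound : ∀ g → demand g ≤ supply g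
    edgeBound g with fin-cases g e | fin-cases g f
    ... | inj₁ refl | _ = edgeBound-e
    ... | inj₂ _ | inj₁ refl = edgeBound-f
    ... | inj₂ g≢e | inj₂ g≢f = edgeBound-other g g≢e g≢f

    Σdemand : Σ' demand ≡ Σ' crossings + 2 * count innerT + 2 * eEnds + 2
    Σdemand = begin
        Σ' demand
          ≡⟨ Σ'-plus2 (λ g → crossings g + 2 * ind (innerT g) + 2 * eEndsInT g) f ⟩
        Σ' (λ g → crossings g + 2 * ind (innerT g) + 2 * eEndsInT g) + 2
          ≡⟨ cong (_+ 2) (Σ'-+ (λ g → crossings g + 2 * ind (innerT g)) (λ g → 2 * eEndsInT g)) ⟩
        Σ' (λ g → crossings g + 2 * ind (innerT g)) + Σ' (λ g → 2 * eEndsInT g) + 2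
          ≡⟨ cong (λ z → z + Σ' (λ g → 2 * eEndsInT g) + 2) (Σ'-+ crossings (λ g → 2 * ind (innerT g))) ⟩
        Σ' crossings + Σ' (λ g → 2 * ind (innerT g)) + Σ' (λ g → 2 * eEndsInT g) + 2
          ≡⟨ cong₂ (λ a b → Σ' crossings + a + b + 2) (Σ'-*ˡ 2 (λ g → ind (innerT g))) (trans (Σ'-*ˡ 2 eEndsInT) (cong (2 *_) atE)) ⟩
        Σ' crossings + 2 * count innerT + 2 * eEnds + 2 ∎
      where
      open ≡-Reasoning
      atE : Σ' eEndsInT ≡ eEnds
      atE = trans (Σ'-point eEndsInT e (λ g g≢e → cong₂ (λ p q → ind (p ∧ T (e1 g)) + ind (q ∧ T (e2 g))) (≡ᵇ-false g≢e) (≡ᵇ-false g≢e)))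
                  (cong₂ (λ p q → ind (p ∧ T (e1 e)) + ind (q ∧ T (e2 e))) (≡ᵇ-refl e) (≡ᵇ-refl e))

    Σsupply : Σ' supply ≡ count T * 3 + 2
    Σsupply = trans (Σ'-plus2 (endsIn T) e) (cong (_+ 2) (sym (handshake T)))

    slack≡0 : 2 * B + 2 * count innerT + 2 * eEnds ≡ 0
    slack≡0 = n≤0⇒n≡0 (+-cancelˡ-≤ (3 * q) _ 0 (begin
        3 * q + (2 * B + 2 * count innerT + 2 * eEnds) ≤⟨ +-cancelʳ-≤ 2 _ _ total ⟩
        count T * 3                                   ≤⟨ *-monoˡ-≤ 3 |T|≤q ⟩
        q * 3                                         ≡⟨ *-comm q 3 ⟩
        3 * q                                         ≡⟨ sym (+-identityʳ (3 * q)) ⟩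
        3 * q + 0                                     ∎))
      where
      open ≤-Reasoning
      regroup : ∀ a b c d → a + (b + c + d) ≡ a + b + c + d
      regroup a b c d = trans (sym (+-assoc a (b + c) d)) (cong (_+ d) (sym (+-assoc a b c)))
      total : 3 * q + (2 * B + 2 * count innerT + 2 * eEnds) + 2 ≤ count T * 3 + 2
      total = begin
        3 * q + (2 * B + 2 * count innerT + 2 * eEnds) + 2 ≡⟨ cong (_+ 2) (regroup (3 * q) (2 * B) (2 * count innerT) (2 * eEnds)) ⟩
        3 * q + 2 * B + 2 * count innerT + 2 * eEnds + 2 ≤⟨ +-monoˡ-≤ 2 (+-monoˡ-≤ (2 * eEnds) (+-monoˡ-≤ (2 * count innerT) classCuts)) ⟩
        Σ' crossings + 2 * count innerT + 2 * eEnds + 2 ≡⟨ sym Σdemand ⟩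
        Σ' demand                                         ≤⟨ Σ'-mono edgeBound ⟩
        Σ' supply                                         ≡⟨ Σsupply ⟩
        count T * 3 + 2                                   ∎

    half≡0 : ∀ x → 2 * x ≡ 0 → x ≡ 0
    half≡0 zero _ = refl

    B≡0 : B ≡ 0
    B≡0 = half≡0 B (m+n≡0⇒m≡0 (2 * B) (m+n≡0⇒m≡0 (2 * B + 2 * count innerT) slack≡0))

    innerT≡0 : count innerT ≡ 0
    innerT≡0 = half≡0 (count innerT) (m+n≡0⇒n≡0 (2 * B) (m+n≡0⇒m≡0 (2 * B + 2 * count innerT) slack≡0))

    eEnds≡0 : eEnds ≡ 0
    eEnds≡0 = half≡0 eEnds (m+n≡0⇒n≡0 (2 * B + 2 * count innerT) slack≡0)

    -- an edge other than e, f with both ends in R would make a class of size ≥ 2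
    noInnerR : ∀ g → g ≢ e → R (e1 g) ≡ true → R (e2 g) ≡ true → ⊥
    noInnerR g g≢e r1 r2 = <-irrefl (sym B≡0) (count-≥1 (λ ℓ → ge2 (classSize ℓ)) ℓ (atLeast2 (count-≥2 (inClass ℓ) (e1 g) (e2 g) (e1≢e2 g) k1 k2)))
      where
      ℓ = lab (e1 g)
      own : ∀ z → R z ≡ true → inClass (lab z) z ≡ true
      own z rz = trans (inClass-R z rz (lab z)) (≡ᵇ-refl (lab z))
      k1 : inClass ℓ (e1 g) ≡ true
      k1 = own (e1 g) r1
      k2 : inClass ℓ (e2 g) ≡ true
      k2 = subst (λ l → inClass l (e2 g) ≡ true) (sym (sameClass g g≢e r1 r2)) (own (e2 g) r2)
      atLeast2 : ∀ {c} → 2 ≤ c → ge2 c ≡ true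
      atLeast2 (s≤s (s≤s _)) = refl

    bipartition : BipartiteSeparating G e f
    bipartition = T , false , proper , ind≡0 (m+n≡0⇒m≡0 _ eEnds≡0) , ind≡0 (m+n≡0⇒n≡0 (ind (T (e1 e))) eEnds≡0)
                , cong not R-u , cong not R-v
      where
      ind≡0 : ∀ {b} → ind b ≡ 0 → b ≡ false
      ind≡0 {false} _ = refl
      proper : ∀ g → g ≢ e → g ≢ f → T (e1 g) ≢ T (e2 g)
      proper g g≢e g≢f same with count-0-inv innerT innerT≡0 g
      ... | notInner rewrite ≡ᵇ-false g≢e | ≡ᵇ-false g≢f with bool-cases (T (e1 g))
      ... | inj₁ t1 = t≢f (∧-intro t1 (trans (sym same) t1)) notInner
      ... | inj₂ t1 = noInnerR g g≢e (not-false⁻¹ t1) (not-false⁻¹ (trans (sym same) t1))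
        where not-false⁻¹ : ∀ {b} → not b ≡ false → b ≡ true
              not-false⁻¹ {true} _ = refl

open import Function.Bundles using (mk⇔)
open import Data.Sum using (inj₁; inj₂)
open import Data.Empty using (⊥-elim)
open import Data.Nat.Properties using (≤-refl)

lemma10 : (G : Multigraph) → Cubic G → Cyclically4EdgeConnected G →
    (e f : Fin (Multigraph.m G)) → e ≢ f →
    (¬ (Σ (Fin (Multigraph.m G) → Bool) λ M →
    PerfectMatching G M × M e ≡ false × M f ≡ true))
    ⇔ BipartiteSeparating G e f
lemma10 G cubic c4 e f e≢f = mk⇔ forward (ColourCount.separated⇒noMatching G cubic e f e≢f)
  where
  open ForcedEdge G e f e≢f using (W; adjH; adjH-sym; module Lift)
  forward : ¬ (Σ (Fin (Multigraph.m G) → Bool) λ M → PerfectMatching G M × M e ≡ false × M f ≡ true) →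
    BipartiteSeparating G e f
  forward noMatching with Tutte.tutte (Matchings.nonEdges W adjH) W adjH adjH-sym ≤-refl
  ... | inj₁ pm = ⊥-elim (noMatching (Lift.liftedMatching pm))
  ... | inj₂ barrier = BarrierAnalysis.bipartition G cubic c4 e f e≢f barrier
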